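{- The exponential generating function $\sum_{n\ge0}\frac{x^n}{n!}\sum_{\pi\in\mathcal F_n}\mathrm{run}(\pi)$ for the total number of runs over all flattened permutations of each length equals $$x+\int_0^x\left(-t\,e^{e^t-1}+e^{t+e^t-1}-1\right)dt=x+\frac{x^2}{2!}+3\frac{x^3}{3!}+9\frac{x^4}{4!}+32\frac{x^5}{5!}+128\frac{x^6}{6!}+565\frac{x^7}{7!}+2719\frac{x^8}{8!}+O(x^9).$$
   Context: A permutation of $[n]$ is written $\pi=\pi_1\cdots\pi_n$; the empty permutation is included for $n=0$. A run is a maximal block of consecutive increasing entries; $\mathrm{run}(\pi)$ is the number of runs (so $\mathrm{run}$ of the empty permutation is $0$). A permutation is flattened if the first entries of its runs, read from left to right, are increasing; $\mathcal F_n$ is the set of flattened permutations of length $n$. -}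

module Defs where

open import Data.Nat as ℕ using (ℕ; zero; suc; _!; _<ᵇ_)
open import Data.Nat.Properties using (_!≢0)
open import Data.Bool using (Bool; true; false; _∧_; if_then_else_)
open import Data.List using (List; []; _∷_; length; map; concatMap; filter)
open import Data.Nat.ListAction using (sum)
open import Data.Integer using (+_)
open import Data.Rational as ℚ using (ℚ; _/_; 0ℚ; 1ℚ; _+_; _*_; -_)

-- Permutations of [n], written as one-line words π₁⋯πₙ (lists of ℕ).

insertions : ℕ → List ℕ → List (List ℕ)
insertions x []       = (x ∷ []) ∷ []
insertions x (y ∷ ys) = (x ∷ y ∷ ys) ∷ map (y ∷_) (insertions x ys)

perms : ℕ → List (List ℕ)
perms zero    = [] ∷ []
perms (suc n) = concatMap (insertions (suc n)) (perms n)

runs : List ℕ → List (List ℕ)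
runs []       = []
runs (x ∷ xs) with runs xs
... | []               = (x ∷ []) ∷ []
... | (y ∷ r) ∷ rs     = if x <ᵇ y then (x ∷ y ∷ r) ∷ rs else (x ∷ []) ∷ (y ∷ r) ∷ rs
... | [] ∷ rs          = (x ∷ []) ∷ rs   -- never occurs (runs are nonempty)

run : List ℕ → ℕ
run π = length (runs π)

firsts : List (List ℕ) → List ℕ
firsts []             = []
firsts ([] ∷ rs)      = firsts rs
firsts ((x ∷ _) ∷ rs) = x ∷ firsts rs

increasing : List ℕ → Bool
increasing []           = true
increasing (x ∷ [])     = true
increasing (x ∷ y ∷ ys) = (x <ᵇ y) ∧ increasing (y ∷ ys)

flattened : List ℕ → Bool
flattened π = increasing (firsts (runs π))

Flat : ℕ → List (List ℕ)
Flat n = filter (λ π → Data.Bool.T? (flattened π)) (perms n)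
  where import Data.Bool

totalRuns : ℕ → ℕ
totalRuns n = sum (map run (Flat n))

-- Formal power series over ℚ, as coefficient sequences.

PS : Set
PS = ℕ → ℚ

Σ≤ : ℕ → (ℕ → ℚ) → ℚ
Σ≤ zero    f = f 0
Σ≤ (suc n) f = Σ≤ n f + f (suc n)

fromℕ : ℕ → ℚ
fromℕ n = + n / 1

inv! : ℕ → ℚ
inv! n = (+ 1 / (n !)) {{n !≢0}}

egf : (ℕ → ℕ) → PS
egf a n = fromℕ (a n) * inv! n

one : PS
one zero    = 1ℚ
one (suc _) = 0ℚ

X : PS
X 1 = 1ℚ
X _ = 0ℚ

_⊕_ : PS → PS → PS
(f ⊕ g) n = f n + g n

⊝_ : PS → PS
(⊝ f) n = - f n

_⊖_ : PS → PS → PS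
f ⊖ g = f ⊕ (⊝ g)

_⊛_ : PS → PS → PS
(f ⊛ g) n = Σ≤ n (λ i → f i * g (n ℕ.∸ i))

infixl 6 _⊕_ _⊖_
infixl 7 _⊛_

pow : PS → ℕ → PS
pow f zero    = one
pow f (suc k) = f ⊛ pow f k

expS : PS
expS = inv!

-- e^{f(t)} for a series f with zero constant term:
-- [tⁿ] e^f = Σ_{k=0}^{n} [tⁿ] fᵏ / k!  (fᵏ has order ≥ k when f(0)=0)
expOf : PS → PS
expOf f n = Σ≤ n (λ k → pow f k n * inv! k)

integral : PS → PS
integral f zero    = 0ℚ
integral f (suc n) = f n * (+ 1 / suc n)

rhs : PS
rhs = X ⊕ integral ((⊝ (X ⊛ expOf (expS ⊖ one))) ⊕ expOf (X ⊕ expS ⊖ one) ⊖ one)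

listed : ℕ → ℕ
listed 0 = 0
listed 1 = 1
listed 2 = 1
listed 3 = 3
listed 4 = 9
listed 5 = 32
listed 6 = 128
listed 7 = 565
listed 8 = 2719
listed _ = 0

module Submission where

-- Label a flattened permutation by (p , a), where p + 1 is its number of runs and a is the
-- number of ascents πᵢ < πᵢ₊₁ whose top is smaller than the first entry of the next run (all
-- ascents of the last run count).
-- Removing the maximum from a flattened permutation leaves a flattened one, and inserting
-- n + 1 into a flattened permutation of [n] with label (p , a) gives one flattened child
-- (p , a + 1) (at the very end), p children (p , a) (at the ends of the other runs), a
-- children (p + 1 , a - 1) (inside the counted ascents), and nothing else.  Hence the level
-- p + a grows like the number of blocks of a set partition: the permutations in 𝓕ₙ₊₁ at
-- level k are counted by S(n, k), |𝓕ₙ₊₁| is the Bell number Bₙ with EGF e^{eᵗ-1}, and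
-- Σ_{π ∈ 𝓕ₘ₊₂} a(π) = (m + 1) Bₘ, so that Σ_{π ∈ 𝓕ₘ₊₂} run(π) = Bₘ₊₂ - (m + 1) Bₘ.  As
-- (e^{eᵗ-1})′ = e^{t+eᵗ-1} (both solve y′ = (1 + eᵗ) y), this is the coefficientwise form of
-- the claimed identity.  The listed values come from iterating the generating tree.

open import Defs
open import Data.Nat using (ℕ; _<_)
open import Data.Product using (_×_)
open import Relation.Binary.PropositionalEquality using (_≡_)

module PowerSeries where

  open import Data.Nat as ℕ using (zero; suc; _!; _∸_; _≤_; z≤n; s≤s)
  import Data.Nat.Properties as ℕP
  open import Data.Integer as ℤ using (+_)
  import Data.Integer.Properties as ℤP
  open import Data.Rational using (ℚ; _/_; 0ℚ; 1ℚ; _+_; _*_; -_; toℚᵘ)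
  import Data.Rational.Properties as ℚP
  import Data.Rational.Unnormalised as U
  import Data.Rational.Unnormalised.Properties as UP
  open import Data.Rational.Solver using (module +-*-Solver)
  open +-*-Solver using (solve; _:+_; _:*_; _:=_; con)
  open import Data.Sum using (inj₁; inj₂)
  open import Relation.Binary.PropositionalEquality
  open ≡-Reasoning

  toℚᵘ-/ : ∀ i d → toℚᵘ (i / suc d) U.≃ U.mkℚᵘ i d
  toℚᵘ-/ i d = ℚP.toℚᵘ-fromℚᵘ (U.mkℚᵘ i d)

  fromℕ-homo-+ : ∀ a b → fromℕ (a ℕ.+ b) ≡ fromℕ a + fromℕ b
  fromℕ-homo-+ a b = ℚP.toℚᵘ-injective (UP.≃-trans (toℚᵘ-/ (+ (a ℕ.+ b)) 0)
    (UP.≃-sym (UP.≃-trans (ℚP.toℚᵘ-homo-+ (fromℕ a) (fromℕ b))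
      (UP.≃-trans (UP.+-cong (toℚᵘ-/ (+ a) 0) (toℚᵘ-/ (+ b) 0)) (U.*≡* cross)))))
    where
    cross : (+ a ℤ.* + 1 ℤ.+ + b ℤ.* + 1) ℤ.* + 1 ≡ + (a ℕ.+ b) ℤ.* (+ 1 ℤ.* + 1)
    cross rewrite ℤP.*-identityʳ (+ a) | ℤP.*-identityʳ (+ b) | ℤP.*-identityʳ (+ a ℤ.+ + b) = sym (ℤP.pos-+ a b)

  fromℕ-homo-* : ∀ a b → fromℕ (a ℕ.* b) ≡ fromℕ a * fromℕ b
  fromℕ-homo-* a b = ℚP.toℚᵘ-injective (UP.≃-trans (toℚᵘ-/ (+ (a ℕ.* b)) 0)
    (UP.≃-sym (UP.≃-trans (ℚP.toℚᵘ-homo-* (fromℕ a) (fromℕ b))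
      (UP.≃-trans (UP.*-cong (toℚᵘ-/ (+ a) 0) (toℚᵘ-/ (+ b) 0)) (U.*≡* cross)))))
    where
    cross : (+ a ℤ.* + b) ℤ.* + 1 ≡ + (a ℕ.* b) ℤ.* (+ 1)
    cross rewrite ℤP.*-identityʳ (+ a ℤ.* + b) | ℤP.*-identityʳ (+ (a ℕ.* b)) = sym (ℤP.pos-* a b)

  fromℕ-split : ∀ {n i} → i ≤ n → fromℕ n ≡ fromℕ i + fromℕ (n ∸ i)
  fromℕ-split {n} {i} i≤n = trans (cong fromℕ (sym (ℕP.m+[n∸m]≡n i≤n))) (fromℕ-homo-+ i (n ∸ i))

  fromℕ-*-recip : ∀ m .{{_ : ℕ.NonZero m}} → fromℕ m * (+ 1 / m) ≡ 1ℚ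
  fromℕ-*-recip (suc k) = ℚP.toℚᵘ-injective (UP.≃-trans (ℚP.toℚᵘ-homo-* (fromℕ (suc k)) (+ 1 / suc k))
    (UP.≃-trans (UP.*-cong (toℚᵘ-/ (+ suc k) 0) (toℚᵘ-/ (+ 1) k)) (U.*≡* cross)))
    where
    cross : (+ suc k ℤ.* + 1) ℤ.* + 1 ≡ + 1 ℤ.* (+ 1 ℤ.* + suc k)
    cross = cong (λ x → + suc x) (trans (ℕP.*-identityʳ (k ℕ.* 1)) (trans (ℕP.*-identityʳ k)
              (sym (trans (ℕP.+-identityʳ (k ℕ.+ 0)) (ℕP.+-identityʳ k)))))

  recip-* : ∀ a b .{{_ : ℕ.NonZero b}} →
            (+ 1 / (suc a ℕ.* b)) {{ℕP.m*n≢0 (suc a) b}} ≡ (+ 1 / suc a) * (+ 1 / b)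
  recip-* a (suc b) = ℚP.toℚᵘ-injective (UP.≃-trans (toℚᵘ-/ (+ 1) (b ℕ.+ a ℕ.* suc b))
    (UP.≃-sym (UP.≃-trans (ℚP.toℚᵘ-homo-* (+ 1 / suc a) (+ 1 / suc b))
      (UP.≃-trans (UP.*-cong (toℚᵘ-/ (+ 1) a) (toℚᵘ-/ (+ 1) b)) (U.*≡* refl)))))

  fromℕ!-*-inv! : ∀ k → fromℕ (k !) * inv! k ≡ 1ℚ
  fromℕ!-*-inv! k = fromℕ-*-recip (k !) {{k ℕP.!≢0}}

  inv!-suc : ∀ n → inv! n ≡ fromℕ (suc n) * inv! (suc n)
  inv!-suc n = sym (begin
    fromℕ (suc n) * inv! (suc n)               ≡⟨ cong (fromℕ (suc n) *_) (recip-* n (n !) {{n ℕP.!≢0}}) ⟩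
    fromℕ (suc n) * ((+ 1 / suc n) * inv! n)   ≡⟨ ℚP.*-assoc (fromℕ (suc n)) _ _ ⟨
    (fromℕ (suc n) * (+ 1 / suc n)) * inv! n   ≡⟨ cong (_* inv! n) (fromℕ-*-recip (suc n)) ⟩
    1ℚ * inv! n                                ≡⟨ ℚP.*-identityˡ _ ⟩
    inv! n                                     ∎)

  *-cancelˡ-fromℕ-suc : ∀ n {a b} → fromℕ (suc n) * a ≡ fromℕ (suc n) * b → a ≡ b
  *-cancelˡ-fromℕ-suc n {a} {b} eq = begin
    a                 ≡⟨ ℚP.*-identityˡ a ⟨
    1ℚ * a            ≡⟨ cong (_* a) inverse ⟨
    (r * m) * a       ≡⟨ ℚP.*-assoc r m a ⟩
    r * (m * a)       ≡⟨ cong (r *_) eq ⟩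
    r * (m * b)       ≡⟨ ℚP.*-assoc r m b ⟨
    (r * m) * b       ≡⟨ cong (_* b) inverse ⟩
    1ℚ * b            ≡⟨ ℚP.*-identityˡ b ⟩
    b                 ∎
    where
    m r : ℚ
    m = fromℕ (suc n)
    r = + 1 / suc n
    inverse : r * m ≡ 1ℚ
    inverse = trans (ℚP.*-comm r m) (fromℕ-*-recip (suc n))

  Σ≤-cong : ∀ n {f g : ℕ → ℚ} → (∀ i → i ≤ n → f i ≡ g i) → Σ≤ n f ≡ Σ≤ n g
  Σ≤-cong zero    f≗g = f≗g 0 z≤n
  Σ≤-cong (suc n) f≗g = cong₂ _+_ (Σ≤-cong n (λ i i≤n → f≗g i (ℕP.m≤n⇒m≤1+n i≤n))) (f≗g (suc n) ℕP.≤-refl)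

  Σ≤-unfoldˡ : ∀ n f → Σ≤ (suc n) f ≡ f 0 + Σ≤ n (λ i → f (suc i))
  Σ≤-unfoldˡ zero    f = refl
  Σ≤-unfoldˡ (suc n) f = trans (cong (_+ f (suc (suc n))) (Σ≤-unfoldˡ n f)) (ℚP.+-assoc (f 0) _ _)

  Σ≤-zero : ∀ n {f} → (∀ i → i ≤ n → f i ≡ 0ℚ) → Σ≤ n f ≡ 0ℚ
  Σ≤-zero zero    f≗0 = f≗0 0 z≤n
  Σ≤-zero (suc n) f≗0 = trans (cong₂ _+_ (Σ≤-zero n (λ i i≤n → f≗0 i (ℕP.m≤n⇒m≤1+n i≤n))) (f≗0 (suc n) ℕP.≤-refl))
                              (ℚP.+-identityʳ 0ℚ)

  Σ≤-+ : ∀ n f g → Σ≤ n (λ i → f i + g i) ≡ Σ≤ n f + Σ≤ n g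
  Σ≤-+ zero    f g = refl
  Σ≤-+ (suc n) f g = trans (cong (_+ (f (suc n) + g (suc n))) (Σ≤-+ n f g))
                           (interchange (Σ≤ n f) (Σ≤ n g) (f (suc n)) (g (suc n)))
    where
    interchange : ∀ a b c d → (a + b) + (c + d) ≡ (a + c) + (b + d)
    interchange = solve 4 (λ a b c d → (a :+ b) :+ (c :+ d) := (a :+ c) :+ (b :+ d)) refl

  Σ≤-*ˡ : ∀ n c f → Σ≤ n (λ i → c * f i) ≡ c * Σ≤ n f
  Σ≤-*ˡ zero    c f = refl
  Σ≤-*ˡ (suc n) c f = trans (cong (_+ (c * f (suc n))) (Σ≤-*ˡ n c f)) (sym (ℚP.*-distribˡ-+ c _ _))

  Σ≤-*ʳ : ∀ n c f → Σ≤ n (λ i → f i * c) ≡ Σ≤ n f * c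
  Σ≤-*ʳ n c f = trans (Σ≤-cong n (λ i _ → ℚP.*-comm (f i) c)) (trans (Σ≤-*ˡ n c f) (ℚP.*-comm c _))

  Σ≤-reverse : ∀ n f → Σ≤ n f ≡ Σ≤ n (λ i → f (n ∸ i))
  Σ≤-reverse zero    f = refl
  Σ≤-reverse (suc n) f = begin
    Σ≤ (suc n) f                                  ≡⟨ Σ≤-unfoldˡ n f ⟩
    f 0 + Σ≤ n (λ i → f (suc i))                  ≡⟨ cong (λ z → f 0 + z) (Σ≤-reverse n (λ i → f (suc i))) ⟩
    f 0 + Σ≤ n (λ i → f (suc (n ∸ i)))            ≡⟨ cong (λ z → f 0 + z) (Σ≤-cong n (λ i i≤n → cong f (sym (ℕP.+-∸-assoc 1 i≤n)))) ⟩
    f 0 + Σ≤ n (λ i → f (suc n ∸ i))              ≡⟨ ℚP.+-comm (f 0) _ ⟩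
    Σ≤ n (λ i → f (suc n ∸ i)) + f 0              ≡⟨ cong (λ j → Σ≤ n (λ i → f (suc n ∸ i)) + f j) (ℕP.n∸n≡0 n) ⟨
    Σ≤ (suc n) (λ i → f (suc n ∸ i))              ∎

  Σ≤-swap : ∀ n m (h : ℕ → ℕ → ℚ) → Σ≤ n (λ i → Σ≤ m (h i)) ≡ Σ≤ m (λ j → Σ≤ n (λ i → h i j))
  Σ≤-swap zero    m h = refl
  Σ≤-swap (suc n) m h = trans (cong (_+ Σ≤ m (h (suc n))) (Σ≤-swap n m h))
                              (sym (Σ≤-+ m (λ j → Σ≤ n (λ i → h i j)) (h (suc n))))

  Σ≤-triangle : ∀ n (h : ℕ → ℕ → ℚ) →
                Σ≤ n (λ i → Σ≤ (n ∸ i) (h i)) ≡ Σ≤ n (λ k → Σ≤ k (λ i → h i (k ∸ i)))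
  Σ≤-triangle zero    h = refl
  Σ≤-triangle (suc n) h = begin
    Σ≤ (suc n) (λ i → Σ≤ (suc n ∸ i) (h i))
      ≡⟨ Σ≤-unfoldˡ n _ ⟩
    Σ≤ (suc n) (h 0) + Σ≤ n (λ i → Σ≤ (n ∸ i) (h (suc i)))
      ≡⟨ cong₂ _+_ (Σ≤-unfoldˡ n (h 0)) (Σ≤-triangle n (λ i → h (suc i))) ⟩
    (h 0 0 + Σ≤ n (λ k → h 0 (suc k))) + Σ≤ n (λ k → Σ≤ k (λ i → h (suc i) (k ∸ i)))
      ≡⟨ ℚP.+-assoc (h 0 0) _ _ ⟩
    h 0 0 + (Σ≤ n (λ k → h 0 (suc k)) + Σ≤ n (λ k → Σ≤ k (λ i → h (suc i) (k ∸ i))))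
      ≡⟨ cong (λ z → h 0 0 + z) (Σ≤-+ n _ _) ⟨
    h 0 0 + Σ≤ n (λ k → h 0 (suc k) + Σ≤ k (λ i → h (suc i) (k ∸ i)))
      ≡⟨ cong (λ z → h 0 0 + z) (Σ≤-cong n (λ k _ → sym (Σ≤-unfoldˡ k (λ i → h i (suc k ∸ i))))) ⟩
    h 0 0 + Σ≤ n (λ k → Σ≤ (suc k) (λ i → h i (suc k ∸ i)))
      ≡⟨ Σ≤-unfoldˡ n _ ⟨
    Σ≤ (suc n) (λ k → Σ≤ k (λ i → h i (k ∸ i)))
      ∎

  Σ≤-pad : ∀ m d (g : ℕ → ℚ) → (∀ j → m < j → g j ≡ 0ℚ) → Σ≤ (d ℕ.+ m) g ≡ Σ≤ m g
  Σ≤-pad m zero    g g≗0 = refl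
  Σ≤-pad m (suc d) g g≗0 = trans (cong₂ _+_ (Σ≤-pad m d g g≗0) (g≗0 (suc (d ℕ.+ m)) (s≤s (ℕP.m≤n+m m d))))
                                 (ℚP.+-identityʳ _)

  ∂ : PS → PS
  ∂ f n = fromℕ (suc n) * f (suc n)

  _·_ : ℚ → PS → PS
  (c · f) n = c * f n

  ⊛-cong : ∀ {f f′ g g′} → (∀ i → f i ≡ f′ i) → (∀ i → g i ≡ g′ i) → ∀ n → (f ⊛ g) n ≡ (f′ ⊛ g′) n
  ⊛-cong f≗f′ g≗g′ n = Σ≤-cong n (λ i _ → cong₂ _*_ (f≗f′ i) (g≗g′ (n ∸ i)))

  ⊛-congˡ : ∀ {f f′} g → (∀ i → f i ≡ f′ i) → ∀ n → (f ⊛ g) n ≡ (f′ ⊛ g) n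
  ⊛-congˡ g f≗f′ = ⊛-cong {g = g} f≗f′ (λ _ → refl)

  ⊛-comm : ∀ f g n → (f ⊛ g) n ≡ (g ⊛ f) n
  ⊛-comm f g n = trans (Σ≤-reverse n _) (Σ≤-cong n (λ i i≤n →
    trans (cong (λ j → f (n ∸ i) * g j) (ℕP.m∸[m∸n]≡n i≤n)) (ℚP.*-comm (f (n ∸ i)) (g i))))

  ⊛-distribʳ-⊕ : ∀ f g h n → ((g ⊕ h) ⊛ f) n ≡ (g ⊛ f) n + (h ⊛ f) n
  ⊛-distribʳ-⊕ f g h n = trans (Σ≤-cong n (λ i _ → ℚP.*-distribʳ-+ (f (n ∸ i)) (g i) (h i))) (Σ≤-+ n _ _)

  ⊛-·ʳ : ∀ c f g n → (f ⊛ (c · g)) n ≡ c * (f ⊛ g) n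
  ⊛-·ʳ c f g n = trans (Σ≤-cong n (λ i _ → swap (f i) (g (n ∸ i)))) (Σ≤-*ˡ n c _)
    where
    swap : ∀ a b → a * (c * b) ≡ c * (a * b)
    swap a b = solve 3 (λ a b c → a :* (c :* b) := c :* (a :* b)) refl a b c

  ⊛-identityˡ : ∀ g n → (one ⊛ g) n ≡ g n
  ⊛-identityˡ g zero    = ℚP.*-identityˡ (g 0)
  ⊛-identityˡ g (suc n) = begin
    (one ⊛ g) (suc n)                                ≡⟨ Σ≤-unfoldˡ n _ ⟩
    1ℚ * g (suc n) + Σ≤ n (λ i → 0ℚ * g (n ∸ i))     ≡⟨ cong₂ _+_ (ℚP.*-identityˡ (g (suc n))) (Σ≤-zero n (λ i _ → ℚP.*-zeroˡ (g (n ∸ i)))) ⟩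
    g (suc n) + 0ℚ                                   ≡⟨ ℚP.+-identityʳ _ ⟩
    g (suc n)                                        ∎

  ⊛-zeroʳ : ∀ f g → (∀ i → g i ≡ 0ℚ) → ∀ n → (f ⊛ g) n ≡ 0ℚ
  ⊛-zeroʳ f g g≗0 n = Σ≤-zero n (λ i _ → trans (cong (f i *_) (g≗0 (n ∸ i))) (ℚP.*-zeroʳ (f i)))

  ⊛-assoc : ∀ f g h n → ((f ⊛ g) ⊛ h) n ≡ (f ⊛ (g ⊛ h)) n
  ⊛-assoc f g h n = begin
    Σ≤ n (λ k → Σ≤ k (λ i → f i * g (k ∸ i)) * h (n ∸ k))
      ≡⟨ Σ≤-cong n (λ k _ → sym (Σ≤-*ʳ k (h (n ∸ k)) _)) ⟩
    Σ≤ n (λ k → Σ≤ k (λ i → (f i * g (k ∸ i)) * h (n ∸ k)))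
      ≡⟨ Σ≤-cong n (λ k k≤n → Σ≤-cong k (λ i i≤k →
           trans (ℚP.*-assoc (f i) _ _) (cong (λ j → f i * (g (k ∸ i) * h j)) (sym (∸-∸ i≤k k≤n))))) ⟩
    Σ≤ n (λ k → Σ≤ k (λ i → f i * (g (k ∸ i) * h (n ∸ i ∸ (k ∸ i)))))
      ≡⟨ Σ≤-triangle n (λ i j → f i * (g j * h (n ∸ i ∸ j))) ⟨
    Σ≤ n (λ i → Σ≤ (n ∸ i) (λ j → f i * (g j * h (n ∸ i ∸ j))))
      ≡⟨ Σ≤-cong n (λ i _ → Σ≤-*ˡ (n ∸ i) (f i) _) ⟩
    Σ≤ n (λ i → f i * Σ≤ (n ∸ i) (λ j → g j * h (n ∸ i ∸ j)))
      ∎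
    where
    ∸-∸ : ∀ {n i k} → i ≤ k → k ≤ n → n ∸ i ∸ (k ∸ i) ≡ n ∸ k
    ∸-∸ {n} {i} {k} i≤k _ = trans (ℕP.∸-+-assoc n i (k ∸ i)) (cong (n ∸_) (ℕP.m+[n∸m]≡n i≤k))

  ∂-⊛ : ∀ f g n → ∂ (f ⊛ g) n ≡ (∂ f ⊛ g) n + (f ⊛ ∂ g) n
  ∂-⊛ f g n = begin
    fromℕ (suc n) * Σ≤ (suc n) T                ≡⟨ Σ≤-*ˡ (suc n) (fromℕ (suc n)) T ⟨
    Σ≤ (suc n) (λ i → fromℕ (suc n) * T i)      ≡⟨ Σ≤-cong (suc n) (λ i i≤ → trans (cong (_* T i) (fromℕ-split i≤))
                                                                                 (ℚP.*-distribʳ-+ (T i) (fromℕ i) _)) ⟩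
    Σ≤ (suc n) (λ i → A i + B i)                ≡⟨ Σ≤-+ (suc n) A B ⟩
    Σ≤ (suc n) A + Σ≤ (suc n) B                 ≡⟨ cong₂ _+_ ΣA ΣB ⟩
    (∂ f ⊛ g) n + (f ⊛ ∂ g) n                   ∎
    where
    T A B : ℕ → ℚ
    T i = f i * g (suc n ∸ i)
    A i = fromℕ i * T i
    B i = fromℕ (suc n ∸ i) * T i
    ΣA : Σ≤ (suc n) A ≡ (∂ f ⊛ g) n
    ΣA = begin
      Σ≤ (suc n) A                          ≡⟨ Σ≤-unfoldˡ n A ⟩
      0ℚ * T 0 + Σ≤ n (λ i → A (suc i))     ≡⟨ cong (_+ Σ≤ n (λ i → A (suc i))) (ℚP.*-zeroˡ (T 0)) ⟩
      0ℚ + Σ≤ n (λ i → A (suc i))           ≡⟨ ℚP.+-identityˡ _ ⟩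
      Σ≤ n (λ i → A (suc i))                ≡⟨ Σ≤-cong n (λ i _ → sym (ℚP.*-assoc (fromℕ (suc i)) _ _)) ⟩
      (∂ f ⊛ g) n                           ∎
    ΣB : Σ≤ (suc n) B ≡ (f ⊛ ∂ g) n
    ΣB = begin
      Σ≤ n B + B (suc n)    ≡⟨ cong (λ z → Σ≤ n B + z) (trans (cong (λ j → fromℕ j * T (suc n)) (ℕP.n∸n≡0 n)) (ℚP.*-zeroˡ (T (suc n)))) ⟩
      Σ≤ n B + 0ℚ           ≡⟨ ℚP.+-identityʳ _ ⟩
      Σ≤ n B                ≡⟨ Σ≤-cong n (λ i i≤n → trans (cong (λ j → fromℕ j * (f i * g j)) (ℕP.+-∸-assoc 1 i≤n))
                                                          (swap (fromℕ (suc (n ∸ i))) (f i) _)) ⟩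
      (f ⊛ ∂ g) n           ∎
      where
      swap : ∀ a b c → a * (b * c) ≡ b * (a * c)
      swap = solve 3 (λ a b c → a :* (b :* c) := b :* (a :* c)) refl

  pow-order : ∀ f → f 0 ≡ 0ℚ → ∀ k n → n < k → pow f k n ≡ 0ℚ
  pow-order f f0≡0 (suc k) n (s≤s n≤k) = Σ≤-zero n term
    where
    term : ∀ i → i ≤ n → f i * pow f k (n ∸ i) ≡ 0ℚ
    term zero    _   = trans (cong (_* pow f k n) f0≡0) (ℚP.*-zeroˡ (pow f k n))
    term (suc i) i<n = trans (cong (f (suc i) *_) (pow-order f f0≡0 k (n ∸ suc i)
      (ℕP.<-≤-trans (ℕP.∸-monoʳ-< {n} {suc i} {0} (s≤s z≤n) i<n) n≤k))) (ℚP.*-zeroʳ (f (suc i)))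

  ∂-pow : ∀ f k n → ∂ (pow f (suc k)) n ≡ fromℕ (suc k) * (∂ f ⊛ pow f k) n
  ∂-pow f zero n = begin
    ∂ (f ⊛ one) n                       ≡⟨ ∂-⊛ f one n ⟩
    (∂ f ⊛ one) n + (f ⊛ ∂ one) n       ≡⟨ cong (λ z → (∂ f ⊛ one) n + z) f⊛∂one≡0 ⟩
    (∂ f ⊛ one) n + 0ℚ                  ≡⟨ ℚP.+-identityʳ _ ⟩
    (∂ f ⊛ one) n                       ≡⟨ ℚP.*-identityˡ _ ⟨
    fromℕ 1 * (∂ f ⊛ one) n             ∎
    where
    f⊛∂one≡0 : (f ⊛ ∂ one) n ≡ 0ℚ
    f⊛∂one≡0 = ⊛-zeroʳ f (∂ one) (λ i → ℚP.*-zeroʳ (fromℕ (suc i))) n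
  ∂-pow f (suc k) n = begin
    ∂ (f ⊛ fᵏ⁺¹) n                               ≡⟨ ∂-⊛ f fᵏ⁺¹ n ⟩
    (∂ f ⊛ fᵏ⁺¹) n + (f ⊛ ∂ fᵏ⁺¹) n              ≡⟨ cong (λ z → (∂ f ⊛ fᵏ⁺¹) n + z) inner ⟩
    (∂ f ⊛ fᵏ⁺¹) n + m * (∂ f ⊛ fᵏ⁺¹) n          ≡⟨ collect ((∂ f ⊛ fᵏ⁺¹) n) m ⟩
    (1ℚ + m) * (∂ f ⊛ fᵏ⁺¹) n                    ≡⟨ cong (_* (∂ f ⊛ fᵏ⁺¹) n) (fromℕ-homo-+ 1 (suc k)) ⟨
    fromℕ (suc (suc k)) * (∂ f ⊛ fᵏ⁺¹) n         ∎
    where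
    fᵏ fᵏ⁺¹ : PS
    fᵏ   = pow f k
    fᵏ⁺¹ = pow f (suc k)
    m : ℚ
    m = fromℕ (suc k)
    collect : ∀ x c → x + c * x ≡ (1ℚ + c) * x
    collect = solve 2 (λ x c → x :+ c :* x := (con 1ℚ :+ c) :* x) refl
    inner : (f ⊛ ∂ fᵏ⁺¹) n ≡ m * (∂ f ⊛ fᵏ⁺¹) n
    inner = begin
      (f ⊛ ∂ fᵏ⁺¹) n             ≡⟨ ⊛-cong {f} (λ _ → refl) (∂-pow f k) n ⟩
      (f ⊛ (m · (∂ f ⊛ fᵏ))) n   ≡⟨ ⊛-·ʳ m f (∂ f ⊛ fᵏ) n ⟩
      m * (f ⊛ (∂ f ⊛ fᵏ)) n     ≡⟨ cong (m *_) (⊛-assoc f (∂ f) fᵏ n) ⟨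
      m * ((f ⊛ ∂ f) ⊛ fᵏ) n     ≡⟨ cong (m *_) (⊛-congˡ fᵏ (⊛-comm f (∂ f)) n) ⟩
      m * ((∂ f ⊛ f) ⊛ fᵏ) n     ≡⟨ cong (m *_) (⊛-assoc (∂ f) f fᵏ n) ⟩
      m * (∂ f ⊛ fᵏ⁺¹) n         ∎

  ∂-expOf : ∀ f → f 0 ≡ 0ℚ → ∀ n → ∂ (expOf f) n ≡ (∂ f ⊛ expOf f) n
  ∂-expOf f f0≡0 n = begin
    fromℕ (suc n) * Σ≤ (suc n) (λ k → pow f k (suc n) * inv! k)
      ≡⟨ cong (fromℕ (suc n) *_) (trans (Σ≤-unfoldˡ n _) (ℚP.+-identityˡ _)) ⟩
    fromℕ (suc n) * Σ≤ n (λ j → pow f (suc j) (suc n) * inv! (suc j))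
      ≡⟨ Σ≤-*ˡ n (fromℕ (suc n)) _ ⟨
    Σ≤ n (λ j → fromℕ (suc n) * (pow f (suc j) (suc n) * inv! (suc j)))
      ≡⟨ Σ≤-cong n (λ j _ → trans (sym (ℚP.*-assoc (fromℕ (suc n)) _ _)) (cong (_* inv! (suc j)) (∂-pow f j n))) ⟩
    Σ≤ n (λ j → (fromℕ (suc j) * c j) * inv! (suc j))
      ≡⟨ Σ≤-cong n (λ j _ → absorb j) ⟩
    Σ≤ n (λ j → c j * inv! j)
      ≡⟨ Σ≤-cong n (λ j _ → sym (Σ≤-*ʳ n (inv! j) _)) ⟩
    Σ≤ n (λ j → Σ≤ n (λ i → (∂ f i * pow f j (n ∸ i)) * inv! j))
      ≡⟨ Σ≤-swap n n _ ⟩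
    Σ≤ n (λ i → Σ≤ n (λ j → (∂ f i * pow f j (n ∸ i)) * inv! j))
      ≡⟨ Σ≤-cong n (λ i _ → trans (Σ≤-cong n (λ j _ → ℚP.*-assoc (∂ f i) _ _)) (Σ≤-*ˡ n (∂ f i) _)) ⟩
    Σ≤ n (λ i → ∂ f i * Σ≤ n (λ j → pow f j (n ∸ i) * inv! j))
      ≡⟨ Σ≤-cong n (λ i i≤n → cong (∂ f i *_) (truncate i≤n)) ⟩
    (∂ f ⊛ expOf f) n
      ∎
    where
    c : ℕ → ℚ
    c j = (∂ f ⊛ pow f j) n
    absorb : ∀ j → (fromℕ (suc j) * c j) * inv! (suc j) ≡ c j * inv! j
    absorb j = trans (solve 3 (λ a b c → (a :* b) :* c := b :* (a :* c)) refl (fromℕ (suc j)) (c j) (inv! (suc j)))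
                     (cong (c j *_) (sym (inv!-suc j)))
    truncate : ∀ {i} → i ≤ n → Σ≤ n (λ j → pow f j (n ∸ i) * inv! j) ≡ Σ≤ (n ∸ i) (λ j → pow f j (n ∸ i) * inv! j)
    truncate {i} i≤n = trans (cong (λ m → Σ≤ m (λ j → pow f j (n ∸ i) * inv! j)) (sym (ℕP.m+[n∸m]≡n i≤n)))
      (Σ≤-pad (n ∸ i) i _ (λ j n∸i<j → trans (cong (_* inv! j) (pow-order f f0≡0 j (n ∸ i) n∸i<j)) (ℚP.*-zeroˡ (inv! j))))

  ∂≡⊛-unique : ∀ (h g g′ : PS) → (∀ n → ∂ g n ≡ (h ⊛ g) n) → (∀ n → ∂ g′ n ≡ (h ⊛ g′) n) →
               g 0 ≡ g′ 0 → ∀ n → g n ≡ g′ n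
  ∂≡⊛-unique h g g′ ode ode′ g0≡g′0 n = upTo n n ℕP.≤-refl
    where
    upTo : ∀ n i → i ≤ n → g i ≡ g′ i
    upTo zero    .zero z≤n = g0≡g′0
    upTo (suc n) i i≤1+n with ℕP.m≤n⇒m<n∨m≡n i≤1+n
    ... | inj₁ (s≤s i≤n) = upTo n i i≤n
    ... | inj₂ refl      = *-cancelˡ-fromℕ-suc n (trans (ode n) (trans
          (Σ≤-cong n (λ j _ → cong (h j *_) (upTo n (n ∸ j) (ℕP.m∸n≤m n j)))) (sym (ode′ n))))

  ∂-expS : ∀ n → ∂ expS n ≡ expS n
  ∂-expS n = sym (inv!-suc n)

  X-⊛-suc : ∀ g m → (X ⊛ g) (suc m) ≡ g m
  X-⊛-suc g zero = begin
    0ℚ * g 1 + 1ℚ * g 0    ≡⟨ cong₂ _+_ (ℚP.*-zeroˡ (g 1)) (ℚP.*-identityˡ (g 0)) ⟩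
    0ℚ + g 0               ≡⟨ ℚP.+-identityˡ (g 0) ⟩
    g 0                    ∎
  X-⊛-suc g (suc m) = begin
    (X ⊛ g) (suc (suc m))
      ≡⟨ Σ≤-unfoldˡ (suc m) _ ⟩
    0ℚ * g (suc (suc m)) + Σ≤ (suc m) (λ i → X (suc i) * g (suc m ∸ i))
      ≡⟨ cong₂ _+_ (ℚP.*-zeroˡ (g (suc (suc m)))) (Σ≤-unfoldˡ m _) ⟩
    0ℚ + (1ℚ * g (suc m) + Σ≤ m (λ i → 0ℚ * g (m ∸ i)))
      ≡⟨ ℚP.+-identityˡ _ ⟩
    1ℚ * g (suc m) + Σ≤ m (λ i → 0ℚ * g (m ∸ i))
      ≡⟨ cong₂ _+_ (ℚP.*-identityˡ (g (suc m))) (Σ≤-zero m (λ i _ → ℚP.*-zeroˡ (g (m ∸ i)))) ⟩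
    g (suc m) + 0ℚ
      ≡⟨ ℚP.+-identityʳ _ ⟩
    g (suc m)
      ∎

module FlattenedPermutations where

  open import Data.Nat as ℕ using (zero; suc; _+_; _*_; _∸_; _≤_; z≤n; s≤s; _<ᵇ_)
  import Data.Nat.Properties as ℕP
  open import Data.Bool using (Bool; true; false; if_then_else_)
  open import Data.Bool.Properties using (T-≡)
  open import Data.Maybe using (Maybe; just; nothing)
  open import Data.List using (List; []; _∷_; length; map; concat; filter)
  open import Data.Nat.ListAction using (sum)
  open import Data.Nat.ListAction.Properties using (sum-++)
  import Data.List.Properties as LP
  open import Data.List.Relation.Unary.All as All using (All; []; _∷_)
  import Data.List.Relation.Unary.All.Properties as AllP
  open import Data.Product using (_×_; _,_)
  open import Data.Sum using (_⊎_; inj₁; inj₂)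
  open import Data.Unit using (⊤; tt)
  open import Data.Empty using (⊥-elim)
  open import Function using (_∘_; module Equivalence)
  open import Relation.Binary.PropositionalEquality
  open import Relation.Nullary using (yes; no)
  open import Data.Nat.Tactic.RingSolver using (solve-∀)
  open ≡-Reasoning

  -- The label of a nonempty word w, computed while reading w from right to left.
  -- `first` is w₁; `clash` is `just f` when the second run starts with f < w₁ and `nothing`
  -- otherwise; `tailFlat` tells whether the runs after the first one have increasing first
  -- entries; w has `p + 1` runs; `a` counts the ascents wᵢ < wᵢ₊₁ whose top wᵢ₊₁ is smaller
  -- than the first entry of the next run (every ascent of the last run counts), and `a₁` counts
  -- those lying in the first run.  For a flattened word only (p , a) matters.
  record Label : Set where
    constructor label
    field
      first    : ℕ
      clash    : Maybe ℕ
      tailFlat : Bool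
      p a a₁   : ℕ

  open Label

  [nothing] : Maybe ℕ → ℕ
  [nothing] nothing  = 1
  [nothing] (just _) = 0

  reclash : ℕ → Maybe ℕ → Maybe ℕ
  reclash y nothing  = nothing
  reclash y (just z) = if y <ᵇ z then nothing else just z

  flatWith : Maybe ℕ → Bool → Bool
  flatWith nothing  P = P
  flatWith (just _) _ = false

  pushWith : Bool → ℕ → Label → Label
  pushWith true  y (label h g P p a a₁) = label y (reclash y g) P p (a + [nothing] g) (a₁ + [nothing] g)
  pushWith false y (label h g P p a a₁) = label y (just h) (flatWith g P) (suc p) a 0

  push : ℕ → Maybe Label → Label
  push y nothing  = label y nothing true 0 0 0
  push y (just s) = pushWith (y <ᵇ first s) y s

  labelOf : List ℕ → Maybe Label
  labelOf []       = nothing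
  labelOf (y ∷ ys) = just (push y (labelOf ys))

  isFlat : Maybe Label → Bool
  isFlat nothing  = true
  isFlat (just s) = flatWith (clash s) (tailFlat s)

  runCount : Maybe Label → ℕ
  runCount nothing  = 0
  runCount (just s) = suc (p s)

  clashWith : ℕ → List ℕ → Maybe ℕ
  clashWith h []      = nothing
  clashWith h (f ∷ _) = if h <ᵇ f then nothing else just f

  record Describes (π : List ℕ) (s : Label) : Set where
    field
      firstRun  : List ℕ
      otherRuns : List (List ℕ)
      runs≡     : runs π ≡ (first s ∷ firstRun) ∷ otherRuns
      length≡   : length otherRuns ≡ p s
      tailFlat≡ : increasing (firsts otherRuns) ≡ tailFlat s
      clash≡    : clash s ≡ clashWith (first s) (firsts otherRuns)

  increasing-∷ : ∀ h fs → increasing (h ∷ fs) ≡ flatWith (clashWith h fs) (increasing fs)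
  increasing-∷ h []       = refl
  increasing-∷ h (f ∷ fs) with h <ᵇ f
  ... | true  = refl
  ... | false = refl

  <⇒<ᵇ≡true : ∀ {m n} → m < n → (m <ᵇ n) ≡ true
  <⇒<ᵇ≡true m<n = Equivalence.to T-≡ (ℕP.<⇒<ᵇ m<n)

  <ᵇ≡true⇒< : ∀ {m n} → (m <ᵇ n) ≡ true → m < n
  <ᵇ≡true⇒< {m} {n} e = ℕP.<ᵇ⇒< m n (Equivalence.from T-≡ e)

  >⇒<ᵇ≡false : ∀ {m n} → n < m → (m <ᵇ n) ≡ false
  >⇒<ᵇ≡false {m} {n} n<m with m <ᵇ n in e
  ... | false = refl
  ... | true  = ⊥-elim (ℕP.<-asym n<m (<ᵇ≡true⇒< e))

  reclash-clashWith : ∀ y h fs → (y <ᵇ h) ≡ true → reclash y (clashWith h fs) ≡ clashWith y fs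
  reclash-clashWith y h []       y<h = refl
  reclash-clashWith y h (f ∷ fs) y<h with h <ᵇ f in h<f
  ... | true  = cong (λ b → if b then nothing else just f)
                     (sym (<⇒<ᵇ≡true (ℕP.<-trans (<ᵇ≡true⇒< {y} {h} y<h) (<ᵇ≡true⇒< {h} {f} h<f))))
  ... | false = refl

  describes-push : ∀ y z zs s → Describes (z ∷ zs) s → Describes (y ∷ z ∷ zs) (pushWith (y <ᵇ first s) y s)
  describes-push y z zs (label h g P p a a₁) record { firstRun = r ; otherRuns = rs ; runs≡ = runs≡ ; length≡ = length≡ ; tailFlat≡ = tailFlat≡ ; clash≡ = clash≡ }
    with y <ᵇ h in y<ᵇh
  ... | true = record { firstRun = h ∷ r ; otherRuns = rs ; runs≡ = joined ; length≡ = length≡ ; tailFlat≡ = tailFlat≡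
                      ; clash≡ = trans (cong (reclash y) clash≡) (reclash-clashWith y h (firsts rs) y<ᵇh) }
    where
    joined : runs (y ∷ z ∷ zs) ≡ (y ∷ h ∷ r) ∷ rs
    joined rewrite runs≡ | y<ᵇh = refl
  ... | false = record { firstRun = [] ; otherRuns = (h ∷ r) ∷ rs ; runs≡ = separate ; length≡ = cong suc length≡
                       ; tailFlat≡ = trans (increasing-∷ h (firsts rs)) (cong₂ flatWith (sym clash≡) tailFlat≡) ; clash≡ = newClash }
    where
    separate : runs (y ∷ z ∷ zs) ≡ (y ∷ []) ∷ (h ∷ r) ∷ rs
    separate rewrite runs≡ | y<ᵇh = refl
    newClash : just h ≡ clashWith y (h ∷ firsts rs)
    newClash rewrite y<ᵇh = refl

  describes-labelOf : ∀ y ys → Describes (y ∷ ys) (push y (labelOf ys))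
  describes-labelOf y []       = record { firstRun = [] ; otherRuns = [] ; runs≡ = refl ; length≡ = refl ; tailFlat≡ = refl ; clash≡ = refl }
  describes-labelOf y (z ∷ zs) = describes-push y z zs (push z (labelOf zs)) (describes-labelOf z zs)

  flattened≡isFlat : ∀ π → flattened π ≡ isFlat (labelOf π)
  flattened≡isFlat []       = refl
  flattened≡isFlat (y ∷ ys) = trans (cong (increasing ∘ firsts) runs≡)
                                    (trans (increasing-∷ _ (firsts otherRuns)) (cong₂ flatWith (sym clash≡) tailFlat≡))
    where open Describes (describes-labelOf y ys)

  run≡runCount : ∀ π → run π ≡ runCount (labelOf π)
  run≡runCount []       = refl
  run≡runCount (y ∷ ys) = trans (cong length runs≡) (cong suc length≡)
    where open Describes (describes-labelOf y ys)

  Consistent : Label → Set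
  Consistent s = (a₁ s ≤ a s) × (clash s ≡ nothing ⊎ a₁ s ≡ 0)

  Consistent? : Maybe Label → Set
  Consistent? nothing  = ⊤
  Consistent? (just s) = Consistent s

  push-ascent : ∀ y h g P p a a₁ → (y <ᵇ h) ≡ true →
                push y (just (label h g P p a a₁)) ≡ label y (reclash y g) P p (a + [nothing] g) (a₁ + [nothing] g)
  push-ascent y h g P p a a₁ y<h rewrite y<h = refl

  push-descent : ∀ y h g P p a a₁ → (y <ᵇ h) ≡ false →
                 push y (just (label h g P p a a₁)) ≡ label y (just h) (flatWith g P) (suc p) a 0
  push-descent y h g P p a a₁ y≮h rewrite y≮h = refl

  consistent-push : ∀ y ms → Consistent? ms → Consistent (push y ms)
  consistent-push y nothing _ = z≤n , inj₁ refl
  consistent-push y (just (label h g P p a a₁)) _ with y <ᵇ h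
  consistent-push y (just (label h g P p a a₁))        _                   | false = z≤n , inj₂ refl
  consistent-push y (just (label h nothing P p a a₁))  (a₁≤a , _)          | true  = ℕP.+-monoˡ-≤ 1 a₁≤a , inj₁ refl
  consistent-push y (just (label h (just z) P p a a₁)) (a₁≤a , inj₂ refl)  | true  = ℕP.+-monoˡ-≤ 0 a₁≤a , inj₂ refl

  consistent-labelOf : ∀ π → Consistent? (labelOf π)
  consistent-labelOf []       = tt
  consistent-labelOf (y ∷ ys) = consistent-push y (labelOf ys) (consistent-labelOf ys)

  first-push : ∀ z ms → first (push z ms) ≡ z
  first-push z nothing  = refl
  first-push z (just s) with z <ᵇ first s
  ... | true  = refl
  ... | false = refl

  tailFlat-push : ∀ y s → tailFlat s ≡ false → tailFlat (push y (just s)) ≡ false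
  tailFlat-push y (label h g P p a a₁) ¬P with y <ᵇ h
  ... | true = ¬P
  tailFlat-push y (label h nothing  P p a a₁) refl | false = refl
  tailFlat-push y (label h (just _) P p a a₁) _    | false = refl

  Σ< : ℕ → (ℕ → ℕ) → ℕ
  Σ< zero    f = 0
  Σ< (suc n) f = Σ< n f + f n

  Σ<-unfoldˡ : ∀ n f → Σ< (suc n) f ≡ f 0 + Σ< n (f ∘ suc)
  Σ<-unfoldˡ zero    f = ℕP.+-comm 0 (f 0)
  Σ<-unfoldˡ (suc n) f = trans (cong (_+ f (suc n)) (Σ<-unfoldˡ n f)) (ℕP.+-assoc (f 0) _ _)

  Σ<-cong : ∀ n {f g : ℕ → ℕ} → (∀ k → k < n → f k ≡ g k) → Σ< n f ≡ Σ< n g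
  Σ<-cong zero    f≗g = refl
  Σ<-cong (suc n) f≗g = cong₂ _+_ (Σ<-cong n (λ k k<n → f≗g k (ℕP.m<n⇒m<1+n k<n))) (f≗g n ℕP.≤-refl)

  Σ<-const : ∀ n c → Σ< n (λ _ → c) ≡ n * c
  Σ<-const zero    c = refl
  Σ<-const (suc n) c = trans (cong (_+ c) (Σ<-const n c)) (ℕP.+-comm (n * c) c)

  [zero] : ℕ → ℕ
  [zero] zero    = 1
  [zero] (suc _) = 0

  -- The insertions of a new maximum after the first entry of a word with label s, grouped by
  -- the label they produce (see the description of Label); exact for weights that vanish on
  -- non-flat tails, since the remaining insertions break the tail.
  AfterFirst : (Maybe Label → ℕ) → Label → ℕ
  AfterFirst F (label h g P p a a₁) =
    p * F (just (label h g P p a a₁)) + F (just (label h g P p (suc a) (a₁ + [zero] p)))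
    + Σ< a₁ (λ k → F (just (label h nothing P (suc p) (a ∸ 1) k)))
    + (a ∸ a₁) * F (just (label h g P (suc p) (a ∸ 1) a₁))

  Insertions : ℕ → (Maybe Label → ℕ) → Maybe Label → ℕ
  Insertions x F nothing  = F (just (push x nothing))
  Insertions x F (just s) = F (just (push x (just s))) + AfterFirst F s

  VanishesOffFlatTails : (Maybe Label → ℕ) → Set
  VanishesOffFlatTails F = ∀ s → tailFlat s ≡ false → F (just s) ≡ 0

  FirstBelow : ℕ → Maybe Label → Set
  FirstBelow x nothing  = ⊤
  FirstBelow x (just s) = first s < x

  ∸-shift-* : ∀ (K : ℕ → ℕ) a a₁ c → a₁ ≤ a → ((a + c) ∸ (a₁ + c)) * K ((a + c) ∸ 1) ≡ (a ∸ a₁) * K ((a ∸ 1) + c)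
  ∸-shift-* K (suc a) a₁ c _   = cong (_* K (a + c)) (trans (cong₂ _∸_ (ℕP.+-comm (suc a) c) (ℕP.+-comm a₁ c)) (ℕP.[m+n]∸[m+o]≡n∸o c (suc a) a₁))
  ∸-shift-* K zero    a₁ c a₁≤0 rewrite ℕP.n≤0⇒n≡0 a₁≤0 | ℕP.n∸n≡0 c = refl

  ∸-split-* : ∀ a a₁ z → a₁ ≤ a → a₁ * z + (a ∸ a₁) * z ≡ a * z
  ∸-split-* a a₁ z a₁≤a = trans (sym (ℕP.*-distribʳ-+ z a₁ (a ∸ a₁))) (cong (_* z) (ℕP.m+[n∸m]≡n a₁≤a))

  -- Prepending y < x to a word commutes with inserting the maximum x, except that x may also
  -- go between y and the old first entry.
  module _ {x y : ℕ} (y<x : y < x) (F : Maybe Label → ℕ) (vanishes : VanishesOffFlatTails F) where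

    private
      F∘push : Maybe Label → ℕ
      F∘push u = F (just (push y u))

      push-x-before : ∀ {h g P p a a₁ b} → h < x → (y <ᵇ h) ≡ b →
                      F∘push (just (push x (just (label h g P p a a₁))))
                      ≡ F (just (label y (if b then nothing else just h) (flatWith g P) (suc p) a 0))
      push-x-before {h} {g} {P} {p} {a} {a₁} h<x y<ᵇh = begin
        F∘push (just (push x (just (label h g P p a a₁))))
          ≡⟨ cong (F∘push ∘ just) (push-descent x h g P p a a₁ (>⇒<ᵇ≡false h<x)) ⟩
        F (just (push y (just (label x (just h) (flatWith g P) (suc p) a 0))))
          ≡⟨ cong (F ∘ just) (push-ascent y x (just h) (flatWith g P) (suc p) a 0 (<⇒<ᵇ≡true y<x)) ⟩
        F (just (label y (reclash y (just h)) (flatWith g P) (suc p) (a + 0) 0))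
          ≡⟨ cong₂ (λ b′ a′ → F (just (label y (if b′ then nothing else just h) (flatWith g P) (suc p) a′ 0)))
                   y<ᵇh (ℕP.+-identityʳ a) ⟩
        F (just (label y (if _ then nothing else just h) (flatWith g P) (suc p) a 0))
          ∎

    firstRunSplits-ascent : ∀ g P p a a₁ → a₁ ≤ a → (g ≡ nothing ⊎ a₁ ≡ 0) →
      Σ< (a₁ + [nothing] g) (λ k → F (just (label y nothing P (suc p) ((a + [nothing] g) ∸ 1) k)))
      ≡ F (just (label y nothing (flatWith g P) (suc p) a 0)) + Σ< a₁ (λ k → F (just (label y nothing P (suc p) ((a ∸ 1) + 1) (k + 1))))
    firstRunSplits-ascent (just z) P p a .0 _ (inj₂ refl) = sym (trans (ℕP.+-identityʳ _) (vanishes _ refl))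
    firstRunSplits-ascent nothing  P p a a₁ a₁≤a _ = begin
      Σ< (a₁ + 1) (λ k → G (a + 1 ∸ 1) k)              ≡⟨ cong (λ n → Σ< n (λ k → G (a + 1 ∸ 1) k)) (ℕP.+-comm a₁ 1) ⟩
      Σ< (suc a₁) (λ k → G (a + 1 ∸ 1) k)              ≡⟨ Σ<-unfoldˡ a₁ _ ⟩
      G (a + 1 ∸ 1) 0 + Σ< a₁ (λ k → G (a + 1 ∸ 1) (suc k))
        ≡⟨ cong₂ _+_ (cong (λ a′ → G a′ 0) (ℕP.m+n∸n≡m a 1)) (Σ<-cong a₁ (λ k k<a₁ → cong₂ G (shift k<a₁) (ℕP.+-comm 1 k))) ⟩
      G a 0 + Σ< a₁ (λ k → G (a ∸ 1 + 1) (k + 1))      ∎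
      where
      G : ℕ → ℕ → ℕ
      G a′ k = F (just (label y nothing P (suc p) a′ k))
      shift : ∀ {k} → k < a₁ → a + 1 ∸ 1 ≡ a ∸ 1 + 1
      shift k<a₁ = trans (ℕP.m+n∸n≡m a 1) (sym (ℕP.m∸n+n≡m (ℕP.≤-trans (s≤s z≤n) (ℕP.<-≤-trans k<a₁ a₁≤a))))

    afterFirst-push-ascent : ∀ h g P p a a₁ → a₁ ≤ a → (g ≡ nothing ⊎ a₁ ≡ 0) → h < x → (y <ᵇ h) ≡ true →
      AfterFirst F (push y (just (label h g P p a a₁))) ≡ Insertions x F∘push (just (label h g P p a a₁))
    afterFirst-push-ascent h g P p a a₁ a₁≤a g⊎a₁ h<x y<h = begin
      AfterFirst F (push y (just (label h g P p a a₁)))   ≡⟨ cong (AfterFirst F) (push-ascent y h g P p a a₁ y<h) ⟩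
      p * U + W + S₂ + L₂                                 ≡⟨ cong₂ (λ s l → p * U + W + s + l) splits (∸-shift-* K a a₁ c a₁≤a) ⟩
      p * U + W + (F₀ + S₁) + L₁                          ≡⟨ rearrange (p * U) W F₀ S₁ L₁ ⟩
      F₀ + (p * U + W + S₁ + L₁)                          ≡⟨ sym (cong₂ _+_ (push-x-before h<x y<h)
                                                               (cong₂ _+_ (cong₂ _+_ (cong₂ _+_ (cong (p *_) runEnds) lastRunEnd) firstRunSplits)
                                                                          (cong ((a ∸ a₁) *_) laterSplits))) ⟩
      Insertions x F∘push (just (label h g P p a a₁))     ∎
      where
      c  = [nothing] g
      g′ = reclash y g
      K : ℕ → ℕ
      K a′ = F (just (label y g′ P (suc p) a′ (a₁ + c)))
      U = F (just (label y g′ P p (a + c) (a₁ + c)))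
      W = F (just (label y g′ P p (suc (a + c)) (a₁ + c + [zero] p)))
      F₀ = F (just (label y nothing (flatWith g P) (suc p) a 0))
      S₁ = Σ< a₁ (λ k → F (just (label y nothing P (suc p) ((a ∸ 1) + 1) (k + 1))))
      S₂ = Σ< (a₁ + c) (λ k → F (just (label y nothing P (suc p) ((a + c) ∸ 1) k)))
      L₁ = (a ∸ a₁) * K ((a ∸ 1) + c)
      L₂ = ((a + c) ∸ (a₁ + c)) * K ((a + c) ∸ 1)
      splits : S₂ ≡ F₀ + S₁
      splits = firstRunSplits-ascent g P p a a₁ a₁≤a g⊎a₁
      rearrange : ∀ A B C D E → A + B + (C + D) + E ≡ C + (A + B + D + E)
      rearrange = solve-∀
      runEnds : F∘push (just (label h g P p a a₁)) ≡ U
      runEnds = cong (F ∘ just) (push-ascent y h g P p a a₁ y<h)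
      lastRunEnd : F∘push (just (label h g P p (suc a) (a₁ + [zero] p))) ≡ W
      lastRunEnd = trans (cong (F ∘ just) (push-ascent y h g P p (suc a) (a₁ + [zero] p) y<h))
        (cong (λ a₁′ → F (just (label y g′ P p (suc (a + c)) a₁′))) (swap a₁ ([zero] p) c))
        where
        swap : ∀ m n o → m + n + o ≡ m + o + n
        swap = solve-∀
      firstRunSplits : Σ< a₁ (λ k → F∘push (just (label h nothing P (suc p) (a ∸ 1) k))) ≡ S₁
      firstRunSplits = Σ<-cong a₁ (λ k _ → cong (F ∘ just) (push-ascent y h nothing P (suc p) (a ∸ 1) k y<h))
      laterSplits : F∘push (just (label h g P (suc p) (a ∸ 1) a₁)) ≡ K ((a ∸ 1) + c)
      laterSplits = cong (F ∘ just) (push-ascent y h g P (suc p) (a ∸ 1) a₁ y<h)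

    splits-descent : ∀ h g P p a a₁ → a₁ ≤ a → (g ≡ nothing ⊎ a₁ ≡ 0) →
      a * F (just (label y (just h) (flatWith g P) (suc (suc p)) (a ∸ 1) 0))
      ≡ a₁ * F (just (label y (just h) P (suc (suc p)) (a ∸ 1) 0))
        + (a ∸ a₁) * F (just (label y (just h) (flatWith g P) (suc (suc p)) (a ∸ 1) 0))
    splits-descent h (just z) P p a .0 _    (inj₂ refl) = refl
    splits-descent h nothing  P p a a₁ a₁≤a _           = sym (∸-split-* a a₁ _ a₁≤a)

    afterFirst-push-descent : ∀ h g P p a a₁ → a₁ ≤ a → (g ≡ nothing ⊎ a₁ ≡ 0) → h < x → (y <ᵇ h) ≡ false →
      AfterFirst F (push y (just (label h g P p a a₁))) ≡ Insertions x F∘push (just (label h g P p a a₁))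
    afterFirst-push-descent h g P p a a₁ a₁≤a g⊎a₁ h<x y≮h = begin
      AfterFirst F (push y (just (label h g P p a a₁)))   ≡⟨ cong (AfterFirst F) (push-descent y h g P p a a₁ y≮h) ⟩
      suc p * V + W + 0 + a * Z                           ≡⟨ cong (suc p * V + W + 0 +_) (splits-descent h g P p a a₁ a₁≤a g⊎a₁) ⟩
      suc p * V + W + 0 + (a₁ * Z′ + (a ∸ a₁) * Z)        ≡⟨ rearrange p V W (a₁ * Z′) ((a ∸ a₁) * Z) ⟩
      V + (p * V + W + a₁ * Z′ + (a ∸ a₁) * Z)            ≡⟨ sym (cong₂ _+_ (push-x-before h<x y≮h)
                                                               (cong₂ _+_ (cong₂ _+_ (cong₂ _+_ (cong (p *_) runEnds) lastRunEnd) firstRunSplits)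
                                                                          (cong ((a ∸ a₁) *_) laterSplits))) ⟩
      Insertions x F∘push (just (label h g P p a a₁))     ∎
      where
      Q = flatWith g P
      V = F (just (label y (just h) Q (suc p) a 0))
      W = F (just (label y (just h) Q (suc p) (suc a) 0))
      Z = F (just (label y (just h) Q (suc (suc p)) (a ∸ 1) 0))
      Z′ = F (just (label y (just h) P (suc (suc p)) (a ∸ 1) 0))
      rearrange : ∀ p V W A B → suc p * V + W + 0 + (A + B) ≡ V + (p * V + W + A + B)
      rearrange = solve-∀
      runEnds : F∘push (just (label h g P p a a₁)) ≡ V
      runEnds = cong (F ∘ just) (push-descent y h g P p a a₁ y≮h)
      lastRunEnd : F∘push (just (label h g P p (suc a) (a₁ + [zero] p))) ≡ W
      lastRunEnd = cong (F ∘ just) (push-descent y h g P p (suc a) (a₁ + [zero] p) y≮h)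
      firstRunSplits : Σ< a₁ (λ k → F∘push (just (label h nothing P (suc p) (a ∸ 1) k))) ≡ a₁ * Z′
      firstRunSplits = trans (Σ<-cong a₁ (λ k _ → cong (F ∘ just) (push-descent y h nothing P (suc p) (a ∸ 1) k y≮h)))
                             (Σ<-const a₁ Z′)
      laterSplits : F∘push (just (label h g P (suc p) (a ∸ 1) a₁)) ≡ Z
      laterSplits = cong (F ∘ just) (push-descent y h g P (suc p) (a ∸ 1) a₁ y≮h)

    afterFirst-push : ∀ ms → Consistent? ms → FirstBelow x ms → AfterFirst F (push y ms) ≡ Insertions x F∘push ms
    afterFirst-push nothing _ _ = trans (trans (ℕP.+-identityʳ _) (ℕP.+-identityʳ _))
                                        (cong (F ∘ just) (sym (push-ascent y x nothing true 0 0 0 (<⇒<ᵇ≡true y<x))))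
    afterFirst-push (just (label h g P p a a₁)) (a₁≤a , g⊎a₁) h<x = byComparison (y <ᵇ h) refl
      where
      byComparison : ∀ b → (y <ᵇ h) ≡ b → AfterFirst F (push y (just (label h g P p a a₁)))
                                         ≡ Insertions x F∘push (just (label h g P p a a₁))
      byComparison true  y<h = afterFirst-push-ascent  h g P p a a₁ a₁≤a g⊎a₁ h<x y<h
      byComparison false y≮h = afterFirst-push-descent h g P p a a₁ a₁≤a g⊎a₁ h<x y≮h

  vanishes-push : ∀ F y → VanishesOffFlatTails F → VanishesOffFlatTails (λ u → F (just (push y u)))
  vanishes-push F y vanishes s ¬P = vanishes _ (tailFlat-push y s ¬P)

  firstBelow-labelOf : ∀ x ys → All (_< x) ys → FirstBelow x (labelOf ys)
  firstBelow-labelOf x []       _           = tt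
  firstBelow-labelOf x (z ∷ zs) (z<x ∷ _)   = subst (_< x) (sym (first-push z (labelOf zs))) z<x

  sum-insertions : ∀ x (F : Maybe Label → ℕ) → VanishesOffFlatTails F → ∀ ys → All (_< x) ys →
                   sum (map (F ∘ labelOf) (insertions x ys)) ≡ Insertions x F (labelOf ys)
  sum-insertions x F vanishes []       _            = ℕP.+-identityʳ _
  sum-insertions x F vanishes (y ∷ ys) (y<x ∷ ys<x) = cong (F (just (push x (just (push y (labelOf ys))))) +_) (begin
    sum (map (F ∘ labelOf) (map (y ∷_) (insertions x ys)))   ≡⟨ cong sum (LP.map-∘ (insertions x ys)) ⟨
    sum (map (F∘push ∘ labelOf) (insertions x ys))           ≡⟨ sum-insertions x F∘push (vanishes-push F y vanishes) ys ys<x ⟩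
    Insertions x F∘push (labelOf ys)                         ≡⟨ afterFirst-push y<x F vanishes (labelOf ys) (consistent-labelOf ys)
                                                                                (firstBelow-labelOf x ys ys<x) ⟨
    AfterFirst F (push y (labelOf ys))                       ∎)
    where
    F∘push : Maybe Label → ℕ
    F∘push u = F (just (push y u))

  -- Ψ n G = Σ_{π ∈ 𝓕ₙ} G (p π) (a π).

  weight : (ℕ → ℕ → ℕ) → Maybe Label → ℕ
  weight G nothing  = 0
  weight G (just s) = if isFlat (just s) then G (p s) (a s) else 0

  weight-vanishes : ∀ G → VanishesOffFlatTails (weight G)
  weight-vanishes G (label h nothing  P p a a₁) refl = refl
  weight-vanishes G (label h (just _) P p a a₁) _    = refl

  Ψ : ℕ → (ℕ → ℕ → ℕ) → ℕ
  Ψ n G = sum (map (weight G ∘ labelOf) (perms n))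

  transfer : (ℕ → ℕ → ℕ) → ℕ → ℕ → ℕ
  transfer G p zero    = G p 1 + p * G p 0
  transfer G p (suc a) = G p (suc (suc a)) + p * G p (suc a) + suc a * G (suc p) a

  insertions-weight : ∀ x G s → Consistent s → first s < x → Insertions x (weight G) (just s) ≡ weight (transfer G) (just s)
  insertions-weight x G (label h g P p a a₁) (a₁≤a , g⊎a₁) h<x =
    trans (cong (λ s′ → weight G (just s′) + AfterFirst (weight G) (label h g P p a a₁)) (push-descent x h g P p a a₁ (>⇒<ᵇ≡false h<x)))
          (byFlatness g P g⊎a₁)
    where
    byFlatness : ∀ g P → (g ≡ nothing ⊎ a₁ ≡ 0) → 0 + AfterFirst (weight G) (label h g P p a a₁) ≡ weight (transfer G) (just (label h g P p a a₁))
    byFlatness (just z) P     (inj₂ refl) rewrite ℕP.*-zeroʳ p | ℕP.*-zeroʳ a = refl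
    byFlatness nothing  false _           rewrite ℕP.*-zeroʳ p | Σ<-const a₁ 0 | ℕP.*-zeroʳ a₁ | ℕP.*-zeroʳ (a ∸ a₁) = refl
    byFlatness nothing  true  _           = begin
      p * G p a + G p (suc a) + Σ< a₁ (λ _ → G (suc p) (a ∸ 1)) + (a ∸ a₁) * G (suc p) (a ∸ 1)
        ≡⟨ cong (λ s → p * G p a + G p (suc a) + s + (a ∸ a₁) * G (suc p) (a ∸ 1)) (Σ<-const a₁ _) ⟩
      p * G p a + G p (suc a) + a₁ * G (suc p) (a ∸ 1) + (a ∸ a₁) * G (suc p) (a ∸ 1)
        ≡⟨ ℕP.+-assoc (p * G p a + G p (suc a)) _ _ ⟩
      p * G p a + G p (suc a) + (a₁ * G (suc p) (a ∸ 1) + (a ∸ a₁) * G (suc p) (a ∸ 1))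
        ≡⟨ cong (p * G p a + G p (suc a) +_) (∸-split-* a a₁ _ a₁≤a) ⟩
      p * G p a + G p (suc a) + a * G (suc p) (a ∸ 1)
        ≡⟨ byAscents a ⟩
      transfer G p a
        ∎
      where
      byAscents : ∀ a → p * G p a + G p (suc a) + a * G (suc p) (a ∸ 1) ≡ transfer G p a
      byAscents zero    = trans (ℕP.+-identityʳ _) (ℕP.+-comm (p * G p 0) (G p 1))
      byAscents (suc a) = cong (_+ suc a * G (suc p) a) (ℕP.+-comm (p * G p (suc a)) (G p (suc (suc a))))

  insertions-bounded : ∀ {Q : ℕ → Set} x π → All Q π → Q x → All (All Q) (insertions x π)
  insertions-bounded x []       _          qx = (qx ∷ []) ∷ []
  insertions-bounded x (y ∷ ys) (qy ∷ qys) qx = (qx ∷ qy ∷ qys) ∷ AllP.map⁺ (All.map (qy ∷_) (insertions-bounded x ys qys qx))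

  insertions-length : ∀ x π → All (λ τ → length τ ≡ suc (length π)) (insertions x π)
  insertions-length x []       = refl ∷ []
  insertions-length x (y ∷ ys) = refl ∷ AllP.map⁺ (All.map (cong suc) (insertions-length x ys))

  perms-bounded : ∀ n → All (All (_≤ n)) (perms n)
  perms-bounded zero    = [] ∷ []
  perms-bounded (suc n) = AllP.concat⁺ (AllP.map⁺ (All.map (λ {π} π≤n →
    insertions-bounded (suc n) π (All.map ℕP.m≤n⇒m≤1+n π≤n) ℕP.≤-refl) (perms-bounded n)))

  perms-length : ∀ n → All (λ π → length π ≡ n) (perms n)
  perms-length zero    = refl ∷ []
  perms-length (suc n) = AllP.concat⁺ (AllP.map⁺ (All.map (λ {π} |π|≡n →
    All.map (λ |τ|≡ → trans |τ|≡ (cong suc |π|≡n)) (insertions-length (suc n) π)) (perms-length n)))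

  sum-concatMap : ∀ {A : Set} (w : A → ℕ) (f : A → List A) xs →
                  sum (map w (concat (map f xs))) ≡ sum (map (λ x → sum (map w (f x))) xs)
  sum-concatMap w f []       = refl
  sum-concatMap w f (x ∷ xs) = trans (cong sum (LP.map-++ w (f x) (concat (map f xs))))
    (trans (sum-++ (map w (f x)) _) (cong (sum (map w (f x)) +_) (sum-concatMap w f xs)))

  Ψ-one : ∀ G → Ψ 1 G ≡ G 0 0
  Ψ-one G = ℕP.+-identityʳ _

  Ψ-suc : ∀ n G → Ψ (suc (suc n)) G ≡ Ψ (suc n) (transfer G)
  Ψ-suc n G = trans (sum-concatMap (weight G ∘ labelOf) (insertions (suc (suc n))) (perms (suc n)))
    (cong sum (LP.map-cong-local (All.zipWith insertAll (perms-bounded (suc n) , perms-length (suc n)))))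
    where
    insertAll : ∀ {π} → All (_≤ suc n) π × length π ≡ suc n →
                sum (map (weight G ∘ labelOf) (insertions (suc (suc n)) π)) ≡ weight (transfer G) (labelOf π)
    insertAll {y ∷ ys} (π≤n , _) =
      trans (sum-insertions (suc (suc n)) (weight G) (weight-vanishes G) (y ∷ ys) (All.map s≤s π≤n))
            (insertions-weight (suc (suc n)) G (push y (labelOf ys)) (consistent-labelOf (y ∷ ys))
                               (firstBelow-labelOf (suc (suc n)) (y ∷ ys) (All.map s≤s π≤n)))

  sum-filter-flattened : ∀ xs → sum (map run (filter (λ π → Data.Bool.T? (flattened π)) xs))
                                ≡ sum (map (λ π → if flattened π then run π else 0) xs)
  sum-filter-flattened []       = refl
  sum-filter-flattened (π ∷ πs) with flattened π
  ... | true  = cong (run π +_) (sum-filter-flattened πs)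
  ... | false = sum-filter-flattened πs

  totalRuns≡Ψ : ∀ n → totalRuns n ≡ Ψ n (λ p a → suc p)
  totalRuns≡Ψ n = trans (sum-filter-flattened (perms n)) (cong sum (LP.map-cong-local (All.universal runWeight (perms n))))
    where
    runWeight : ∀ π → (if flattened π then run π else 0) ≡ weight (λ p a → suc p) (labelOf π)
    runWeight π rewrite flattened≡isFlat π | run≡runCount π with labelOf π
    ... | nothing = refl
    ... | just s with isFlat (just s)
    ...   | true  = refl
    ...   | false = refl

  weight-cong : ∀ G H → (∀ p a → G p a ≡ H p a) → ∀ u → weight G u ≡ weight H u
  weight-cong G H G≗H nothing  = refl
  weight-cong G H G≗H (just s) with isFlat (just s)
  ... | true  = G≗H (p s) (a s)
  ... | false = refl

  weight-+ : ∀ G H u → weight (λ p a → G p a + H p a) u ≡ weight G u + weight H u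
  weight-+ G H nothing  = refl
  weight-+ G H (just s) with isFlat (just s)
  ... | true  = refl
  ... | false = refl

  weight-* : ∀ c G u → weight (λ p a → c * G p a) u ≡ c * weight G u
  weight-* c G nothing  = sym (ℕP.*-zeroʳ c)
  weight-* c G (just s) with isFlat (just s)
  ... | true  = refl
  ... | false = sym (ℕP.*-zeroʳ c)

  sum-map-+ : ∀ {A : Set} (f g : A → ℕ) xs → sum (map (λ x → f x + g x) xs) ≡ sum (map f xs) + sum (map g xs)
  sum-map-+ f g []       = refl
  sum-map-+ f g (x ∷ xs) = trans (cong (f x + g x +_) (sum-map-+ f g xs)) (interchange (f x) (g x) _ _)
    where
    interchange : ∀ a b c d → a + b + (c + d) ≡ a + c + (b + d)
    interchange = solve-∀

  sum-map-* : ∀ {A : Set} c (f : A → ℕ) xs → sum (map (λ x → c * f x) xs) ≡ c * sum (map f xs)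
  sum-map-* c f []       = sym (ℕP.*-zeroʳ c)
  sum-map-* c f (x ∷ xs) = trans (cong (c * f x +_) (sum-map-* c f xs)) (sym (ℕP.*-distribˡ-+ c (f x) _))

  Ψ-cong : ∀ n G H → (∀ p a → G p a ≡ H p a) → Ψ n G ≡ Ψ n H
  Ψ-cong n G H G≗H = cong sum (LP.map-cong (λ π → weight-cong G H G≗H (labelOf π)) (perms n))

  Ψ-+ : ∀ n G H → Ψ n (λ p a → G p a + H p a) ≡ Ψ n G + Ψ n H
  Ψ-+ n G H = trans (cong sum (LP.map-cong (λ π → weight-+ G H (labelOf π)) (perms n)))
                    (sum-map-+ (weight G ∘ labelOf) (weight H ∘ labelOf) (perms n))

  Ψ-* : ∀ n c G → Ψ n (λ p a → c * G p a) ≡ c * Ψ n G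
  Ψ-* n c G = trans (cong sum (LP.map-cong (λ π → weight-* c G (labelOf π)) (perms n)))
                    (sum-map-* c (weight G ∘ labelOf) (perms n))

  Ψ-cong-≤ : ∀ n G H → (∀ p a → p + a ≤ n → G p a ≡ H p a) → Ψ (suc n) G ≡ Ψ (suc n) H
  Ψ-cong-≤ zero    G H G≗H = trans (Ψ-one G) (trans (G≗H 0 0 z≤n) (sym (Ψ-one H)))
  Ψ-cong-≤ (suc n) G H G≗H = trans (Ψ-suc n G) (trans (Ψ-cong-≤ n (transfer G) (transfer H) transfer≗) (sym (Ψ-suc n H)))
    where
    transfer≗ : ∀ p a → p + a ≤ n → transfer G p a ≡ transfer H p a
    transfer≗ p zero    p+0≤n = cong₂ _+_ (G≗H p 1 (subst (_≤ suc n) (sym (ℕP.+-comm p 1)) (s≤s (subst (_≤ n) (ℕP.+-identityʳ p) p+0≤n))))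
                                          (cong (p *_) (G≗H p 0 (ℕP.m≤n⇒m≤1+n p+0≤n)))
    transfer≗ p (suc a) p+a<n = cong₂ _+_ (cong₂ _+_ (G≗H p (suc (suc a)) (subst (_≤ suc n) (sym (ℕP.+-suc p (suc a))) (s≤s p+a<n)))
                                                     (cong (p *_) (G≗H p (suc a) (ℕP.m≤n⇒m≤1+n p+a<n))))
                                          (cong (suc a *_) (G≗H (suc p) a (subst (_≤ suc n) (ℕP.+-suc p a) (ℕP.m≤n⇒m≤1+n p+a<n))))

  transferⁿ : ℕ → (ℕ → ℕ → ℕ) → ℕ
  transferⁿ zero    G = G 0 0
  transferⁿ (suc n) G = transferⁿ n (transfer G)

  Ψ≡transferⁿ : ∀ n G → Ψ (suc n) G ≡ transferⁿ n G
  Ψ≡transferⁿ zero    G = Ψ-one G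
  Ψ≡transferⁿ (suc n) G = trans (Ψ-suc n G) (Ψ≡transferⁿ n (transfer G))


  transfer-level : ∀ (K : ℕ → ℕ) p a → transfer (λ p a → K (p + a)) p a ≡ K (suc (p + a)) + (p + a) * K (p + a)
  transfer-level K p zero    rewrite ℕP.+-identityʳ p | ℕP.+-comm p 1 = refl
  transfer-level K p (suc a) rewrite ℕP.+-suc p (suc a) | ℕP.+-suc p a = collect (K (suc (suc (p + a)))) (K (suc (p + a))) p a
    where
    collect : ∀ Y X p a → Y + p * X + suc a * X ≡ Y + suc (p + a) * X
    collect = solve-∀

  Ψ-level : ∀ n K → Ψ (suc (suc n)) (λ p a → K (p + a)) ≡ Ψ (suc n) (λ p a → K (suc (p + a)) + (p + a) * K (p + a))
  Ψ-level n K = trans (Ψ-suc n _) (Ψ-cong (suc n) _ _ (transfer-level K))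

  transfer-ascents : ∀ (H : ℕ → ℕ) p a →
    transfer (λ p a → a * H (p + a)) p a ≡ a * (H (suc (p + a)) + (p + a ∸ 1) * H (p + a)) + H (suc (p + a))
  transfer-ascents H p zero    rewrite ℕP.+-identityʳ p | ℕP.+-comm p 1 | ℕP.*-zeroʳ p =
    trans (ℕP.+-identityʳ _) (ℕP.+-identityʳ _)
  transfer-ascents H p (suc a) rewrite ℕP.+-suc p (suc a) | ℕP.+-suc p a = collect (H (suc (suc (p + a)))) (H (suc (p + a))) p a
    where
    collect : ∀ H₂ H₁ p a → suc (suc a) * H₂ + p * (suc a * H₁) + suc a * (a * H₁) ≡ suc a * (H₂ + (p + a) * H₁) + H₂
    collect = solve-∀

  Ψ-ascents : ∀ n H → Ψ (suc (suc n)) (λ p a → a * H (p + a)) ≡ suc n * Ψ (suc n) (λ p a → H (suc (p + a)))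
  Ψ-ascents zero    H = trans (Ψ-suc 0 G) (trans (Ψ-one (transfer G)) (trans (ℕP.+-identityʳ _) (cong (1 *_) (sym (Ψ-one (λ p a → H (suc (p + a))))))))
    where
    G : ℕ → ℕ → ℕ
    G p a = a * H (p + a)
  Ψ-ascents (suc n) H = begin
    Ψ (suc (suc (suc n))) (λ p a → a * H (p + a))                ≡⟨ Ψ-suc (suc n) _ ⟩
    Ψ (suc (suc n)) (transfer (λ p a → a * H (p + a)))           ≡⟨ Ψ-cong (suc (suc n)) _ _ (transfer-ascents H) ⟩
    Ψ (suc (suc n)) (λ p a → a * H′ (p + a) + H (suc (p + a)))   ≡⟨ Ψ-+ (suc (suc n)) _ _ ⟩
    Ψ (suc (suc n)) (λ p a → a * H′ (p + a)) + Z                 ≡⟨ cong (_+ Z) (Ψ-ascents n H′) ⟩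
    suc n * Ψ (suc n) (λ p a → H′ (suc (p + a))) + Z             ≡⟨ cong (λ z → suc n * z + Z) (Ψ-level n (H ∘ suc)) ⟨
    suc n * Z + Z                                                ≡⟨ ℕP.+-comm (suc n * Z) Z ⟩
    suc (suc n) * Z                                              ∎
    where
    H′ : ℕ → ℕ
    H′ t = H (suc t) + (t ∸ 1) * H t
    Z = Ψ (suc (suc n)) (λ p a → H (suc (p + a)))

  flatCount : ℕ → ℕ
  flatCount n = Ψ n (λ _ _ → 1)

  totalRuns-flatCount : ∀ m → totalRuns (suc (suc m)) + suc m * flatCount (suc m) ≡ flatCount (suc (suc (suc m)))
  totalRuns-flatCount m = begin
    totalRuns (suc (suc m)) + suc m * flatCount (suc m)                ≡⟨ cong₂ _+_ (totalRuns≡Ψ (suc (suc m))) (sym (Ψ-ascents m (λ _ → 1))) ⟩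
    Ψ (suc (suc m)) (λ p a → suc p) + Ψ (suc (suc m)) (λ p a → a * 1)  ≡⟨ Ψ-+ (suc (suc m)) _ _ ⟨
    Ψ (suc (suc m)) (λ p a → suc p + a * 1)                            ≡⟨ Ψ-cong (suc (suc m)) _ _ (λ p a → cong suc (runsPlusAscents p a)) ⟩
    Ψ (suc (suc m)) (λ p a → 1 + (p + a) * 1)                          ≡⟨ Ψ-level (suc m) (λ _ → 1) ⟨
    flatCount (suc (suc (suc m)))                                      ∎
    where
    runsPlusAscents : ∀ p a → p + a * 1 ≡ (p + a) * 1
    runsPlusAscents = solve-∀

  δ : ℕ → ℕ → ℕ
  δ t k = if t ℕ.≡ᵇ k then 1 else 0

  δ-refl : ∀ t → δ t t ≡ 1
  δ-refl t rewrite Equivalence.to T-≡ (ℕP.≡⇒≡ᵇ t t refl) = refl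

  δ-≢ : ∀ {t k} → t ≢ k → δ t k ≡ 0
  δ-≢ {t} {k} t≢k with t ℕ.≡ᵇ k in t≡ᵇk
  ... | true  = ⊥-elim (t≢k (ℕP.≡ᵇ⇒≡ t k (Equivalence.from T-≡ t≡ᵇk)))
  ... | false = refl

  *-δ : ∀ t k → t * δ t k ≡ k * δ t k
  *-δ t k with t ℕ.≟ k
  ... | yes refl = refl
  ... | no  t≢k  rewrite δ-≢ t≢k = trans (ℕP.*-zeroʳ t) (sym (ℕP.*-zeroʳ k))

  -- #{π ∈ 𝓕ₙ₊₁ : p + a = k}, the Stirling number S(n, k).
  flatLevel : ℕ → ℕ → ℕ
  flatLevel n k = Ψ (suc n) (λ p a → δ (p + a) k)

  flatLevel-zero : ∀ k → flatLevel 0 k ≡ δ 0 k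
  flatLevel-zero k = Ψ-one (λ p a → δ (p + a) k)

  flatLevel-suc-zero : ∀ n → flatLevel (suc n) 0 ≡ 0
  flatLevel-suc-zero n = trans (Ψ-level n (λ t → δ t 0))
    (trans (Ψ-cong (suc n) _ (λ p a → 0 * 0) (λ p a → *-δ (p + a) 0)) (Ψ-* (suc n) 0 (λ p a → 0)))

  flatLevel-suc-suc : ∀ n k → flatLevel (suc n) (suc k) ≡ flatLevel n k + suc k * flatLevel n (suc k)
  flatLevel-suc-suc n k = trans (Ψ-level n (λ t → δ t (suc k)))
    (trans (Ψ-cong (suc n) _ _ (λ p a → cong (δ (p + a) k +_) (*-δ (p + a) (suc k))))
    (trans (Ψ-+ (suc n) _ _) (cong (flatLevel n k +_) (Ψ-* (suc n) (suc k) _))))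

  Σℕ≤ : ℕ → (ℕ → ℕ) → ℕ
  Σℕ≤ zero    f = f 0
  Σℕ≤ (suc n) f = Σℕ≤ n f + f (suc n)

  Σℕ≤-δ-above : ∀ n t → n < t → Σℕ≤ n (δ t) ≡ 0
  Σℕ≤-δ-above zero    t 0<t = δ-≢ (ℕP.>⇒≢ 0<t)
  Σℕ≤-δ-above (suc n) t n<t = cong₂ _+_ (Σℕ≤-δ-above n t (ℕP.<-trans (ℕP.n<1+n n) n<t)) (δ-≢ (ℕP.>⇒≢ n<t))

  Σℕ≤-δ : ∀ n t → t ≤ n → Σℕ≤ n (δ t) ≡ 1
  Σℕ≤-δ zero    zero z≤n = refl
  Σℕ≤-δ (suc n) t  t≤1+n with ℕP.m≤n⇒m<n∨m≡n t≤1+n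
  ... | inj₁ (s≤s t≤n) = cong₂ _+_ (Σℕ≤-δ n t t≤n) (δ-≢ (ℕP.<⇒≢ (s≤s t≤n)))
  ... | inj₂ refl      = cong₂ _+_ (Σℕ≤-δ-above n (suc n) ℕP.≤-refl) (δ-refl (suc n))

  Ψ-Σℕ≤ : ∀ m n (G : ℕ → ℕ → ℕ → ℕ) → Ψ m (λ p a → Σℕ≤ n (λ k → G k p a)) ≡ Σℕ≤ n (λ k → Ψ m (G k))
  Ψ-Σℕ≤ m zero    G = refl
  Ψ-Σℕ≤ m (suc n) G = trans (Ψ-+ m _ _) (cong (_+ Ψ m (G (suc n))) (Ψ-Σℕ≤ m n G))

  flatCount≡Σℕ≤flatLevel : ∀ n → flatCount (suc n) ≡ Σℕ≤ n (flatLevel n)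
  flatCount≡Σℕ≤flatLevel n = trans (Ψ-cong-≤ n _ _ (λ p a p+a≤n → sym (Σℕ≤-δ n (p + a) p+a≤n)))
                                   (Ψ-Σℕ≤ (suc n) n (λ k p a → δ (p + a) k))

open import Data.Nat as ℕ using (zero; suc; _!; s≤s)
open import Data.Integer using (+_)
open import Data.Rational using (ℚ; _/_; 0ℚ; 1ℚ; _+_; _*_; -_)
import Data.Rational.Properties as ℚP
open import Data.Rational.Solver using (module +-*-Solver)
open +-*-Solver using (solve; _:+_; _:*_; :-_; _:=_)
open import Data.Product using (_,_)
open import Relation.Binary.PropositionalEquality
open ≡-Reasoning
open PowerSeries
open FlattenedPermutations
  using (flatCount; flatLevel; flatLevel-zero; flatLevel-suc-zero; flatLevel-suc-suc; Σℕ≤; flatCount≡Σℕ≤flatLevel;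
         totalRuns-flatCount; totalRuns≡Ψ; transferⁿ; Ψ≡transferⁿ)

eᵗ-1 t+eᵗ-1 : PS
eᵗ-1    = expS ⊖ one
t+eᵗ-1  = X ⊕ expS ⊖ one

∂-eᵗ-1 : ∀ n → ∂ eᵗ-1 n ≡ expS n
∂-eᵗ-1 n = trans (cong (fromℕ (suc n) *_) (ℚP.+-identityʳ (inv! (suc n)))) (∂-expS n)

∂-t+eᵗ-1 : ∀ n → ∂ t+eᵗ-1 n ≡ (one ⊕ expS) n
∂-t+eᵗ-1 zero    = refl
∂-t+eᵗ-1 (suc n) = begin
  fromℕ (suc (suc n)) * ((0ℚ + inv! (suc (suc n))) + - 0ℚ)  ≡⟨ cong (fromℕ (suc (suc n)) *_) (trans (ℚP.+-identityʳ _) (ℚP.+-identityˡ _)) ⟩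
  ∂ expS (suc n)                                            ≡⟨ ∂-expS (suc n) ⟩
  inv! (suc n)                                              ≡⟨ ℚP.+-identityˡ _ ⟨
  0ℚ + inv! (suc n)                                         ∎

-- Differentiating (eᵗ - 1)ᵏ⁺¹ gives the recurrence of k! S(n, k) / n!.
pow-eᵗ-1-suc : ∀ k n → fromℕ (suc n) * pow eᵗ-1 (suc k) (suc n) ≡ fromℕ (suc k) * (pow eᵗ-1 (suc k) n + pow eᵗ-1 k n)
pow-eᵗ-1-suc k n = begin
  ∂ (pow eᵗ-1 (suc k)) n                                    ≡⟨ ∂-pow eᵗ-1 k n ⟩
  fromℕ (suc k) * (∂ eᵗ-1 ⊛ pow eᵗ-1 k) n                   ≡⟨ cong (fromℕ (suc k) *_) (⊛-congˡ (pow eᵗ-1 k) (λ i → trans (∂-eᵗ-1 i) (expS≡ i)) n) ⟩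
  fromℕ (suc k) * ((eᵗ-1 ⊕ one) ⊛ pow eᵗ-1 k) n             ≡⟨ cong (fromℕ (suc k) *_) (⊛-distribʳ-⊕ (pow eᵗ-1 k) eᵗ-1 one n) ⟩
  fromℕ (suc k) * (pow eᵗ-1 (suc k) n + (one ⊛ pow eᵗ-1 k) n) ≡⟨ cong (λ z → fromℕ (suc k) * (pow eᵗ-1 (suc k) n + z)) (⊛-identityˡ (pow eᵗ-1 k) n) ⟩
  fromℕ (suc k) * (pow eᵗ-1 (suc k) n + pow eᵗ-1 k n)       ∎
  where
  expS≡ : ∀ i → expS i ≡ (eᵗ-1 ⊕ one) i
  expS≡ i = solve 2 (λ a b → a := (a :+ (:- b)) :+ b) refl (inv! i) (one i)

pow-eᵗ-1≡flatLevel : ∀ n k → pow eᵗ-1 k n ≡ fromℕ (flatLevel n k) * inv! n * fromℕ (k !)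
pow-eᵗ-1≡flatLevel zero    zero    = cong (λ c → fromℕ c * inv! 0 * fromℕ 1) (sym (flatLevel-zero 0))
pow-eᵗ-1≡flatLevel zero    (suc k) = trans (ℚP.*-zeroˡ (pow eᵗ-1 k 0)) (sym (begin
  fromℕ (flatLevel 0 (suc k)) * inv! 0 * fromℕ (suc k !)   ≡⟨ cong (λ c → fromℕ c * inv! 0 * fromℕ (suc k !)) (flatLevel-zero (suc k)) ⟩
  0ℚ * inv! 0 * fromℕ (suc k !)                            ≡⟨ cong (_* fromℕ (suc k !)) (ℚP.*-zeroˡ (inv! 0)) ⟩
  0ℚ * fromℕ (suc k !)                                     ≡⟨ ℚP.*-zeroˡ (fromℕ (suc k !)) ⟩
  0ℚ                                                       ∎))
pow-eᵗ-1≡flatLevel (suc n) zero    = sym (begin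
  fromℕ (flatLevel (suc n) 0) * inv! (suc n) * fromℕ 1     ≡⟨ cong (λ c → fromℕ c * inv! (suc n) * fromℕ 1) (flatLevel-suc-zero n) ⟩
  0ℚ * inv! (suc n) * fromℕ 1                              ≡⟨ cong (_* fromℕ 1) (ℚP.*-zeroˡ (inv! (suc n))) ⟩
  0ℚ                                                       ∎)
pow-eᵗ-1≡flatLevel (suc n) (suc k) = *-cancelˡ-fromℕ-suc n (begin
  N * pow eᵗ-1 (suc k) (suc n)                             ≡⟨ pow-eᵗ-1-suc k n ⟩
  S * (pow eᵗ-1 (suc k) n + pow eᵗ-1 k n)                  ≡⟨ cong (S *_) (cong₂ _+_ (pow-eᵗ-1≡flatLevel n (suc k)) (pow-eᵗ-1≡flatLevel n k)) ⟩
  S * (B * inv! n * fromℕ (suc k ℕ.* k !) + A * inv! n * K)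
    ≡⟨ cong₂ (λ i f → S * (B * i * f + A * i * K)) (inv!-suc n) (fromℕ-homo-* (suc k) (k !)) ⟩
  S * (B * (N * I) * (S * K) + A * (N * I) * K)
    ≡⟨ solve 6 (λ S B N I K A → S :* (B :* (N :* I) :* (S :* K) :+ A :* (N :* I) :* K)
                               := N :* ((A :+ S :* B) :* I :* (S :* K))) refl S B N I K A ⟩
  N * ((A + S * B) * I * (S * K))
    ≡⟨ cong₂ (λ c f → N * (c * I * f)) (sym stirling) (sym (fromℕ-homo-* (suc k) (k !))) ⟩
  N * (fromℕ (flatLevel (suc n) (suc k)) * I * fromℕ (suc k !)) ∎)
  where
  N S I K A B : ℚ
  N = fromℕ (suc n)
  S = fromℕ (suc k)
  I = inv! (suc n)
  K = fromℕ (k !)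
  A = fromℕ (flatLevel n k)
  B = fromℕ (flatLevel n (suc k))
  stirling : fromℕ (flatLevel (suc n) (suc k)) ≡ A + S * B
  stirling = trans (cong fromℕ (flatLevel-suc-suc n k))
                   (trans (fromℕ-homo-+ (flatLevel n k) _) (cong (λ z → A + z) (fromℕ-homo-* (suc k) (flatLevel n (suc k)))))

fromℕ-Σℕ≤ : ∀ n f → fromℕ (Σℕ≤ n f) ≡ Σ≤ n (λ k → fromℕ (f k))
fromℕ-Σℕ≤ zero    f = refl
fromℕ-Σℕ≤ (suc n) f = trans (fromℕ-homo-+ (Σℕ≤ n f) (f (suc n))) (cong (_+ fromℕ (f (suc n))) (fromℕ-Σℕ≤ n f))

expOf-eᵗ-1≡flatCount : ∀ n → expOf eᵗ-1 n ≡ fromℕ (flatCount (suc n)) * inv! n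
expOf-eᵗ-1≡flatCount n = begin
  Σ≤ n (λ k → pow eᵗ-1 k n * inv! k)             ≡⟨ Σ≤-cong n (λ k _ → trans (cong (_* inv! k) (pow-eᵗ-1≡flatLevel n k)) (cancel! k)) ⟩
  Σ≤ n (λ k → fromℕ (flatLevel n k) * inv! n)    ≡⟨ Σ≤-*ʳ n (inv! n) _ ⟩
  Σ≤ n (λ k → fromℕ (flatLevel n k)) * inv! n    ≡⟨ cong (_* inv! n) (fromℕ-Σℕ≤ n (flatLevel n)) ⟨
  fromℕ (Σℕ≤ n (flatLevel n)) * inv! n           ≡⟨ cong (λ c → fromℕ c * inv! n) (flatCount≡Σℕ≤flatLevel n) ⟨
  fromℕ (flatCount (suc n)) * inv! n             ∎
  where
  cancel! : ∀ k → fromℕ (flatLevel n k) * inv! n * fromℕ (k !) * inv! k ≡ fromℕ (flatLevel n k) * inv! n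
  cancel! k = trans (ℚP.*-assoc (fromℕ (flatLevel n k) * inv! n) (fromℕ (k !)) (inv! k))
                    (trans (cong (fromℕ (flatLevel n k) * inv! n *_) (fromℕ!-*-inv! k)) (ℚP.*-identityʳ _))

∂-expOf-eᵗ-1 : ∀ n → ∂ (expOf eᵗ-1) n ≡ (expS ⊛ expOf eᵗ-1) n
∂-expOf-eᵗ-1 n = trans (∂-expOf eᵗ-1 refl n) (⊛-congˡ (expOf eᵗ-1) ∂-eᵗ-1 n)

∂-expOf-t+eᵗ-1 : ∀ n → ∂ (expOf t+eᵗ-1) n ≡ ((one ⊕ expS) ⊛ expOf t+eᵗ-1) n
∂-expOf-t+eᵗ-1 n = trans (∂-expOf t+eᵗ-1 refl n) (⊛-congˡ (expOf t+eᵗ-1) ∂-t+eᵗ-1 n)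

∂∂-expOf-eᵗ-1 : ∀ n → ∂ (∂ (expOf eᵗ-1)) n ≡ ((one ⊕ expS) ⊛ ∂ (expOf eᵗ-1)) n
∂∂-expOf-eᵗ-1 n = begin
  fromℕ (suc n) * ∂ E (suc n)         ≡⟨ cong (fromℕ (suc n) *_) (∂-expOf-eᵗ-1 (suc n)) ⟩
  ∂ (expS ⊛ E) n                      ≡⟨ ∂-⊛ expS E n ⟩
  (∂ expS ⊛ E) n + (expS ⊛ ∂ E) n     ≡⟨ cong (_+ (expS ⊛ ∂ E) n) (trans (⊛-congˡ E ∂-expS n) (sym (∂-expOf-eᵗ-1 n))) ⟩
  ∂ E n + (expS ⊛ ∂ E) n              ≡⟨ cong (_+ (expS ⊛ ∂ E) n) (⊛-identityˡ (∂ E) n) ⟨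
  (one ⊛ ∂ E) n + (expS ⊛ ∂ E) n      ≡⟨ ⊛-distribʳ-⊕ (∂ E) one expS n ⟨
  ((one ⊕ expS) ⊛ ∂ E) n              ∎
  where
  E : PS
  E = expOf eᵗ-1

expOf-t+eᵗ-1≡∂ : ∀ n → expOf t+eᵗ-1 n ≡ ∂ (expOf eᵗ-1) n
expOf-t+eᵗ-1≡∂ = ∂≡⊛-unique (one ⊕ expS) (expOf t+eᵗ-1) (∂ (expOf eᵗ-1)) ∂-expOf-t+eᵗ-1 ∂∂-expOf-eᵗ-1 refl

rhs-suc-suc : ∀ m → rhs (suc (suc m)) ≡ (fromℕ (suc (suc m)) * expOf eᵗ-1 (suc (suc m)) + - expOf eᵗ-1 m) * (+ 1 / suc (suc m))
rhs-suc-suc m = begin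
  0ℚ + ((- (X ⊛ E) (suc m) + expOf t+eᵗ-1 (suc m)) + - 0ℚ) * r
    ≡⟨ cong₂ (λ u v → 0ℚ + ((- u + v) + - 0ℚ) * r) (X-⊛-suc E m) (expOf-t+eᵗ-1≡∂ (suc m)) ⟩
  0ℚ + ((- E m + ∂ E (suc m)) + - 0ℚ) * r
    ≡⟨ solve 3 (λ e d r → con 0ℚ :+ (((:- e) :+ d) :+ (:- con 0ℚ)) :* r := (d :+ (:- e)) :* r) refl (E m) (∂ E (suc m)) r ⟩
  (∂ E (suc m) + - E m) * r
    ∎
  where
  open +-*-Solver using (con)
  E : PS
  E = expOf eᵗ-1
  r : ℚ
  r = + 1 / suc (suc m)

totalRuns≡ : ∀ m → fromℕ (totalRuns (suc (suc m))) ≡ fromℕ (flatCount (suc (suc (suc m)))) + - (fromℕ (suc m) * fromℕ (flatCount (suc m)))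
totalRuns≡ m = begin
  T                   ≡⟨ solve 2 (λ t u → t := (t :+ u) :+ (:- u)) refl T U ⟩
  (T + U) + - U       ≡⟨ cong (λ v → v + - U) (trans (sym (fromℕ-homo-+ (totalRuns (suc (suc m))) (suc m ℕ.* flatCount (suc m)))) (cong fromℕ (totalRuns-flatCount m))) ⟩
  B₃ + - U            ≡⟨ cong (λ v → B₃ + - v) (fromℕ-homo-* (suc m) (flatCount (suc m))) ⟩
  B₃ + - (fromℕ (suc m) * fromℕ (flatCount (suc m))) ∎
  where
  T U B₃ : ℚ
  T  = fromℕ (totalRuns (suc (suc m)))
  U  = fromℕ (suc m ℕ.* flatCount (suc m))
  B₃ = fromℕ (flatCount (suc (suc (suc m))))

egf-totalRuns : ∀ n → egf totalRuns n ≡ rhs n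
egf-totalRuns zero          = refl
egf-totalRuns (suc zero)    = refl
egf-totalRuns (suc (suc m)) = sym (begin
  rhs (suc (suc m))                                         ≡⟨ rhs-suc-suc m ⟩
  (M₂ * expOf eᵗ-1 (suc (suc m)) + - expOf eᵗ-1 m) * r      ≡⟨ cong₂ (λ u v → (M₂ * u + - v) * r) (expOf-eᵗ-1≡flatCount (suc (suc m))) (expOf-eᵗ-1≡flatCount m) ⟩
  (M₂ * (B₃ * I) + - (B₁ * inv! m)) * r                     ≡⟨ cong (λ i → (M₂ * (B₃ * I) + - (B₁ * i)) * r) inv!-m ⟩
  (M₂ * (B₃ * I) + - (B₁ * (M₁ * (M₂ * I)))) * r
    ≡⟨ solve 6 (λ M₁ M₂ B₁ B₃ I r → (M₂ :* (B₃ :* I) :+ (:- (B₁ :* (M₁ :* (M₂ :* I))))) :* r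
                                    := (M₂ :* r) :* ((B₃ :+ (:- (M₁ :* B₁))) :* I)) refl M₁ M₂ B₁ B₃ I r ⟩
  (M₂ * r) * ((B₃ + - (M₁ * B₁)) * I)                       ≡⟨ cong₂ (λ u v → u * (v * I)) (fromℕ-*-recip (suc (suc m))) (sym (totalRuns≡ m)) ⟩
  1ℚ * (fromℕ (totalRuns (suc (suc m))) * I)                ≡⟨ ℚP.*-identityˡ _ ⟩
  fromℕ (totalRuns (suc (suc m))) * I                       ∎)
  where
  M₁ M₂ B₁ B₃ I r : ℚ
  M₁ = fromℕ (suc m)
  M₂ = fromℕ (suc (suc m))
  B₁ = fromℕ (flatCount (suc m))
  B₃ = fromℕ (flatCount (suc (suc (suc m))))
  I  = inv! (suc (suc m))
  r  = + 1 / suc (suc m)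
  inv!-m : inv! m ≡ M₁ * (M₂ * I)
  inv!-m = trans (inv!-suc m) (cong (M₁ *_) (inv!-suc (suc m)))

totalRuns-upTo8 : ∀ n → n < 9 → totalRuns n ≡ listed n
totalRuns-upTo8 zero    _   = refl
totalRuns-upTo8 (suc n) n<8 = trans (totalRuns≡Ψ (suc n)) (trans (Ψ≡transferⁿ n _) (byComputation n n<8))
  where
  byComputation : ∀ n → suc n < 9 → transferⁿ n (λ p a → suc p) ≡ listed (suc n)
  byComputation 0 _ = refl
  byComputation 1 _ = refl
  byComputation 2 _ = refl
  byComputation 3 _ = refl
  byComputation 4 _ = refl
  byComputation 5 _ = refl
  byComputation 6 _ = refl
  byComputation 7 _ = refl
  byComputation (suc (suc (suc (suc (suc (suc (suc (suc n)))))))) (s≤s (s≤s (s≤s (s≤s (s≤s (s≤s (s≤s (s≤s (s≤s ())))))))))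

corollary3p7 : ((n : ℕ) → egf totalRuns n ≡ rhs n)
    × ((n : ℕ) → n < 9 → rhs n ≡ egf listed n)
corollary3p7 = egf-totalRuns , λ n n<9 → trans (sym (egf-totalRuns n)) (cong (λ t → fromℕ t * inv! n) (totalRuns-upTo8 n n<9))
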